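{- For $0\le i\le N$ and every $y\in X$ with $\dim y=i$, $$A y^{\uparrow\downarrow}=\theta_{i}\,y^{\uparrow\downarrow}+\sum_{y\ \mathrm{covers}\ z} z^{\uparrow\downarrow},\qquad A^*y^{\uparrow\downarrow}=\theta^*_i\,y^{\uparrow\downarrow}+(q^{ -1}-1)q^{ -i}\sum_{z\ \mathrm{covers}\ y} z^{\uparrow\downarrow}.$$
   Context: Let $q$ be a prime power and $N\ge1$ an integer. Let $\mathbb V$ be an $N$-dimensional vector space over $\mathrm{GF}(q)$, and let $X$ be the set of all subspaces of $\mathbb V$, ordered by inclusion $\le$. For $y,z\in X$, say $z$ covers $y$ if $y\subseteq z$ and $\dim z-\dim y=1$. Let $V=\mathbb R^X$ with standard basis $\{\hat y\}_{y\in X}$. Define $A\in\mathrm{Mat}_X(\mathbb R)$ by $A_{y,z}=1$ if $y$ covers $z$, $A_{y,z}=q^{\dim y}$ if $z$ covers $y$, and $0$ otherwise; define the diagonal matrix $A^*$ by $A^*_{y,y}=q^{ -\dim y}$. Put $\theta_i=(q^{N-i}-q^i)/(q-1)$ and $\theta^*_i=q^{ -i}$ for $0\le i\le N$. For $y\in X$ define $y^{\uparrow\downarrow}=q^{\binom{N-\dim y}{2}}\sum_{y\le z}q^{(N-\dim z)\dim y}\,\hat z$. -}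

module Defs where

open import Level using (0ℓ)
open import Data.Bool using (Bool; true; false; _∧_; _∨_; not; if_then_else_; T)
open import Data.Nat as ℕ using (ℕ; zero; suc; _∸_; _^_)
open import Data.Nat.Combinatorics using (_C_)
open import Data.Integer using (+_)
import Data.Rational as Q
open Q using (ℚ; 0ℚ; 1ℚ)
open import Data.List using (List; []; _∷_; length; map; concatMap; foldr; mapMaybe)
open import Data.Bool.ListAction using (all; any)
open import Data.List.Membership.Propositional using (_∈_)
open import Data.List.Relation.Unary.Unique.Propositional using (Unique)
open import Data.Vec as V using (Vec; toList; replicate; zipWith)
open import Data.Vec.Properties using (≡-dec)
open import Data.Maybe using (Maybe; just; nothing)
open import Data.Product using (Σ; ∃; _,_; proj₁)
open import Relation.Nullary using (¬_; yes; no)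
open import Relation.Nullary.Decidable using (⌊_⌋)
open import Relation.Binary.PropositionalEquality using (_≡_; _≢_)
open import Relation.Binary.Definitions using (DecidableEquality)
open import Algebra.Structures using (IsCommutativeRing)
open import Data.Bool.Properties using (T?)

record FiniteField : Set₁ where
  field
    F      : Set
    _⊕_    : F → F → F
    _⊗_    : F → F → F
    ⊖_     : F → F
    0F     : F
    1F     : F
    isCommutativeRing : IsCommutativeRing _≡_ _⊕_ _⊗_ ⊖_ 0F 1F
    0≢1    : 0F ≢ 1F
    inverse : ∀ x → x ≢ 0F → ∃ λ y → x ⊗ y ≡ 1F
    _≟F_   : DecidableEquality F
    elements          : List F
    elements-unique   : Unique elements
    elements-complete : ∀ x → x ∈ elements

  q : ℕ
  q = length elements

vecsOver : {A : Set} → (k : ℕ) → List A → List (Vec A k)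
vecsOver zero    xs = V.[] ∷ []
vecsOver (suc k) xs = concatMap (λ x → map (x V.∷_) (vecsOver k xs)) xs

ℕ→ℚ : ℕ → ℚ
ℕ→ℚ n = (+ n) Q./ 1

-- 1/n  (junk value 0 at n = 0; only ever used with n ≥ 1 since q ≥ 2)
inv : ℕ → ℚ
inv zero    = 0ℚ
inv (suc n) = (+ 1) Q./ (suc n)

module Setting (𝔽 : FiniteField) (N : ℕ) where
  open FiniteField 𝔽

  Vect : Set
  Vect = Vec F N

  _≟v_ : DecidableEquality Vect
  _≟v_ = ≡-dec _≟F_

  zeroV : Vect
  zeroV = replicate N 0F

  _+v_ : Vect → Vect → Vect
  _+v_ = zipWith _⊕_

  _·v_ : F → Vect → Vect
  c ·v u = V.map (c ⊗_) u

  allVecs : List Vect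
  allVecs = vecsOver N elements

  isSubspaceB : (Vect → Bool) → Bool
  isSubspaceB m =
    m zeroV
    ∧ all (λ u → all (λ v → not (m u ∧ m v) ∨ m (u +v v)) allVecs) allVecs
    ∧ all (λ c → all (λ u → not (m u) ∨ m (c ·v u)) allVecs) elements

  X : Set
  X = Σ (Vect → Bool) (λ m → T (isSubspaceB m))

  mem : X → Vect → Bool
  mem = proj₁

  -- enumeration of X: every subset of 𝕍 is a Boolean table over allVecs
  tableLookup : List Vect → List Bool → Vect → Bool
  tableLookup (u ∷ us) (b ∷ bs) v = if ⌊ u ≟v v ⌋ then b else tableLookup us bs v
  tableLookup _        _        v = false

  toX : (Vect → Bool) → Maybe X
  toX m with T? (isSubspaceB m)
  ... | yes p = just (m , p)
  ... | no  _ = nothing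

  allX : List X
  allX = mapMaybe (λ bs → toX (tableLookup allVecs (toList bs)))
                  (vecsOver (length allVecs) (true ∷ false ∷ []))

  eqX : X → X → Bool
  eqX y z = all (λ v → (not (mem y v) ∨ mem z v) ∧ (not (mem z v) ∨ mem y v)) allVecs

  _≤X_ : X → X → Bool
  y ≤X z = all (λ v → not (mem y v) ∨ mem z v) allVecs

  -- dimension = maximal size of a linearly independent list in y
  lincomb : {k : ℕ} → Vec F k → Vec Vect k → Vect
  lincomb V.[]       V.[]       = zeroV
  lincomb (c V.∷ cs) (v V.∷ vs) = (c ·v v) +v lincomb cs vs

  isZero : {k : ℕ} → Vec F k → Bool
  isZero u = all (λ a → ⌊ a ≟F 0F ⌋) (toList u)

  independent : {k : ℕ} → Vec Vect k → Bool
  independent {k} vs =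
    all (λ c → not (isZero (lincomb c vs)) ∨ isZero c) (vecsOver k elements)

  hasIndep : X → ℕ → Bool
  hasIndep y k = any (λ vs → all (mem y) (toList vs) ∧ independent vs)
                     (vecsOver k allVecs)

  dimUpTo : X → ℕ → ℕ
  dimUpTo y zero    = 0
  dimUpTo y (suc k) = if hasIndep y (suc k) then suc k else dimUpTo y k

  dim : X → ℕ
  dim y = dimUpTo y N

  covers : X → X → Bool
  covers z y = (y ≤X z) ∧ ⌊ dim z ℕ.≟ suc (dim y) ⌋

  𝒱 : Set
  𝒱 = X → ℚ

  _+ᵥ_ : 𝒱 → 𝒱 → 𝒱
  (u +ᵥ v) w = u w Q.+ v w

  _·ᵥ_ : ℚ → 𝒱 → 𝒱
  (a ·ᵥ u) w = a Q.* u w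

  0ᵥ : 𝒱
  0ᵥ w = 0ℚ

  sumℚ : List ℚ → ℚ
  sumℚ = foldr Q._+_ 0ℚ

  ΣX : (X → ℚ) → ℚ
  ΣX f = sumℚ (map f allX)

  ΣXᵥ : (X → 𝒱) → 𝒱
  ΣXᵥ u w = ΣX (λ z → u z w)

  hat : X → 𝒱
  hat y w = if eqX y w then 1ℚ else 0ℚ

  Matrix : Set
  Matrix = X → X → ℚ

  _∙_ : Matrix → 𝒱 → 𝒱
  (M ∙ u) y = ΣX (λ z → M y z Q.* u z)

  qℚ^ : ℕ → ℚ
  qℚ^ n = ℕ→ℚ (q ^ n)

  qℚ^- : ℕ → ℚ
  qℚ^- n = inv (q ^ n)

  A : Matrix
  A y z = if covers y z then 1ℚ
          else if covers z y then qℚ^ (dim y)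
          else 0ℚ

  A* : Matrix
  A* y z = if eqX y z then qℚ^- (dim y) else 0ℚ

  θ : ℕ → ℚ
  θ i = (qℚ^ (N ∸ i) Q.- qℚ^ i) Q.* inv (q ∸ 1)

  θ* : ℕ → ℚ
  θ* i = qℚ^- i

  updown : X → 𝒱
  updown y = qℚ^ ((N ∸ dim y) C 2) ·ᵥ
             ΣXᵥ (λ z → if y ≤X z then qℚ^ ((N ∸ dim z) ℕ.* dim y) ·ᵥ hat z else 0ᵥ)

-- Evaluated at a subspace w, y^↑↓ is q^C(N − dim y, 2) · [y ≤ w] · q^((N − dim w) dim y). So at each w
-- both identities are sums over the neighbours of w (on the left) or of y (on the right), and everything
-- reduces to counting subspaces. The basic fact is |y| = q^dim y. Double counting the pairs (z , u) with
-- u ∈ z ∖ y shows that an interval [y, w] of length k has [k]_q atoms and, by induction on k, [k]_q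
-- coatoms; this covers the case y ≤ w. If y ⊄ w, pick v ∈ y ∖ w: the only cover of w above y is w + ⟨v⟩
-- and the only subspace covered by y inside w is y ∩ w, both exist exactly when y ≤ w + ⟨v⟩, and their
-- contributions cancel. Clearing denominators then leaves polynomial identities in q.

module Submission where

open import Defs
open import Level using (0ℓ)
open import Function using (_∘_; Equivalence)
open import Data.Nat as ℕ using (ℕ; zero; suc; _+_; _*_; _∸_; _^_; _≤_; _<_; z≤n; s≤s; NonZero)
open import Data.Nat.Properties
open import Data.Nat.Combinatorics using (_C_; nCk+nC[k+1]≡[n+1]C[k+1]; nC1≡n)
import Data.Nat.Solver as ℕSolver
import Data.Integer as ℤ
import Data.Integer.Properties as ℤP
import Data.Rational as Q
open Q using (ℚ; 0ℚ; 1ℚ; mkℚ)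
import Data.Rational.Properties as ℚP
import Data.Rational.Solver as QSolver
open import Data.Nat.Coprimality as Coprimality using (1-coprimeTo)
open import Data.Bool as Bool using (Bool; true; false; T; if_then_else_; _∧_; _∨_; not)
open import Data.Bool.Properties using (T-∧; T?)
open import Data.Bool.ListAction using (all; any)
open import Data.List using (List; []; _∷_; map; concatMap; _++_; length; mapMaybe)
open import Data.List.Membership.Propositional using (_∈_; lose)
open import Data.List.Relation.Unary.Any as Any using (here; there)
open import Data.List.Relation.Unary.Any.Properties using (any⁺; any⁻)
import Data.List.Relation.Unary.All as All
open import Data.List.Relation.Unary.All using ([]; _∷_)
open import Data.List.Relation.Unary.All.Properties using (all⁺; all⁻)
open import Data.List.Relation.Unary.AllPairs using ([]; _∷_)
open import Data.List.Relation.Unary.Unique.Propositional using (Unique)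
open import Data.Maybe using (Maybe; just; nothing; maybe)
open import Data.Vec as V using (Vec; toList)
open import Data.Vec.Properties
  using (≡-dec; ∷-injectiveˡ; ∷-injectiveʳ; zipWith-assoc; zipWith-comm; zipWith-identityˡ; zipWith-identityʳ;
         map-cong; map-id; map-const; map-∘; map-replicate)
open import Data.Product using (Σ-syntax; ∃; _×_; _,_; proj₁; proj₂)
open import Data.Sum using (_⊎_; inj₁; inj₂)
open import Data.Empty using (⊥; ⊥-elim)
open import Data.Unit using (tt)
open import Relation.Nullary using (Dec; yes; no; ¬_)
open import Relation.Nullary.Decidable using (⌊_⌋; toWitness; fromWitness)
open import Relation.Binary.Definitions using (DecidableEquality)
open import Relation.Binary.PropositionalEquality
open import Algebra.Structures using (IsCommutativeRing)
open import Algebra.Bundles using (Ring; AbelianGroup)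
open import Relation.Binary.PropositionalEquality.Algebra using (isMagma)
import Algebra.Properties.AbelianGroup as AbelianGroupProperties
import Algebra.Properties.CommutativeSemigroup as CommutativeSemigroupProperties
import Algebra.Properties.Ring as RingProperties

open CommutativeSemigroupProperties +-commutativeSemigroup using () renaming (interchange to +-interchange)

∧-elim : {a b : Bool} → T (a ∧ b) → T a × T b
∧-elim {a} {b} = Equivalence.to (T-∧ {a} {b})

∧-intro : {a b : Bool} → T a → T b → T (a ∧ b)
∧-intro {a} {b} ta tb = Equivalence.from (T-∧ {a} {b}) (ta , tb)

⇒-elim : {a b : Bool} → T (not a ∨ b) → T a → T b
⇒-elim {true} {true} _ _ = tt

⇒-intro : {a b : Bool} → (T a → T b) → T (not a ∨ b)
⇒-intro {false} a⇒b = tt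
⇒-intro {true}  a⇒b = a⇒b tt

not-intro : {a : Bool} → ¬ T a → T (not a)
not-intro {false} _   = tt
not-intro {true}  ¬ta = ¬ta tt

not-elim : {a : Bool} → T (not a) → ¬ T a
not-elim {false} _ ()

Bool-ext : {a b : Bool} → (T a → T b) → (T b → T a) → a ≡ b
Bool-ext {false} {false} _   _   = refl
Bool-ext {false} {true}  _   b⇒a = ⊥-elim (b⇒a tt)
Bool-ext {true}  {false} a⇒b _   = ⊥-elim (a⇒b tt)
Bool-ext {true}  {true}  _   _   = refl

module _ {A : Set} {xs : List A} (complete : ∀ x → x ∈ xs) (p : A → Bool) where

  all-elim : T (all p xs) → ∀ x → T (p x)
  all-elim t x = All.lookup (all⁺ p xs t) (complete x)

  all-intro : (∀ x → T (p x)) → T (all p xs)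
  all-intro f = all⁻ p {xs} (All.tabulate (λ {x} _ → f x))

  any-intro : (x : A) → T (p x) → T (any p xs)
  any-intro x px = any⁺ p (lose (complete x) px)

any-elim : {A : Set} (p : A → Bool) (xs : List A) → T (any p xs) → ∃ (T ∘ p)
any-elim p xs t = Any.satisfied (any⁻ p xs t)

∑ : {A : Set} → List A → (A → ℕ) → ℕ
∑ []       f = 0
∑ (x ∷ xs) f = f x + ∑ xs f

module _ {A : Set} where

  ∑-cong : (xs : List A) {f g : A → ℕ} → (∀ x → f x ≡ g x) → ∑ xs f ≡ ∑ xs g
  ∑-cong []       f≗g = refl
  ∑-cong (x ∷ xs) f≗g = cong₂ _+_ (f≗g x) (∑-cong xs f≗g)

  ∑-zero : (xs : List A) → ∑ xs (λ _ → 0) ≡ 0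
  ∑-zero []       = refl
  ∑-zero (x ∷ xs) = ∑-zero xs

  ∑-const : (xs : List A) (c : ℕ) → ∑ xs (λ _ → c) ≡ length xs * c
  ∑-const []       c = refl
  ∑-const (x ∷ xs) c = cong (c +_) (∑-const xs c)

  ∑-distrib-+ : (xs : List A) (f g : A → ℕ) → ∑ xs (λ x → f x + g x) ≡ ∑ xs f + ∑ xs g
  ∑-distrib-+ []       f g = refl
  ∑-distrib-+ (x ∷ xs) f g =
    trans (cong (f x + g x +_) (∑-distrib-+ xs f g)) (+-interchange (f x) (g x) (∑ xs f) (∑ xs g))

  ∑-*ˡ : (xs : List A) (c : ℕ) (f : A → ℕ) → ∑ xs (λ x → c * f x) ≡ c * ∑ xs f
  ∑-*ˡ []       c f = sym (*-zeroʳ c)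
  ∑-*ˡ (x ∷ xs) c f = trans (cong (c * f x +_) (∑-*ˡ xs c f)) (sym (*-distribˡ-+ c (f x) (∑ xs f)))

  ∑-*ʳ : (xs : List A) (c : ℕ) (f : A → ℕ) → ∑ xs (λ x → f x * c) ≡ ∑ xs f * c
  ∑-*ʳ xs c f = trans (∑-cong xs (λ x → *-comm (f x) c)) (trans (∑-*ˡ xs c f) (*-comm c (∑ xs f)))

  ∑-mono-≤ : (xs : List A) {f g : A → ℕ} → (∀ x → f x ≤ g x) → ∑ xs f ≤ ∑ xs g
  ∑-mono-≤ []       f≤g = z≤n
  ∑-mono-≤ (x ∷ xs) f≤g = +-mono-≤ (f≤g x) (∑-mono-≤ xs f≤g)

  ∑-mono-< : (xs : List A) {f g : A → ℕ} → (∀ x → f x ≤ g x) → {a : A} → a ∈ xs → f a < g a → ∑ xs f < ∑ xs g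
  ∑-mono-< (x ∷ xs) f≤g (here refl) fa<ga = +-mono-<-≤ fa<ga (∑-mono-≤ xs f≤g)
  ∑-mono-< (x ∷ xs) f≤g (there a∈xs) fa<ga = +-mono-≤-< (f≤g x) (∑-mono-< xs f≤g a∈xs fa<ga)

  ∑-++ : (xs ys : List A) (f : A → ℕ) → ∑ (xs ++ ys) f ≡ ∑ xs f + ∑ ys f
  ∑-++ []       ys f = refl
  ∑-++ (x ∷ xs) ys f = trans (cong (f x +_) (∑-++ xs ys f)) (sym (+-assoc (f x) (∑ xs f) (∑ ys f)))

module _ {A B : Set} where

  ∑-map : (xs : List A) (g : A → B) (f : B → ℕ) → ∑ (map g xs) f ≡ ∑ xs (f ∘ g)
  ∑-map []       g f = refl
  ∑-map (x ∷ xs) g f = cong (f (g x) +_) (∑-map xs g f)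

  ∑-concatMap : (xs : List A) (g : A → List B) (f : B → ℕ) → ∑ (concatMap g xs) f ≡ ∑ xs (λ x → ∑ (g x) f)
  ∑-concatMap []       g f = refl
  ∑-concatMap (x ∷ xs) g f = trans (∑-++ (g x) (concatMap g xs) f) (cong (∑ (g x) f +_) (∑-concatMap xs g f))

  ∑-comm : (xs : List A) (ys : List B) (f : A → B → ℕ) → ∑ xs (λ x → ∑ ys (f x)) ≡ ∑ ys (λ y → ∑ xs (λ x → f x y))
  ∑-comm []       ys f = sym (∑-zero ys)
  ∑-comm (x ∷ xs) ys f =
    trans (cong (∑ ys (f x) +_) (∑-comm xs ys f)) (sym (∑-distrib-+ ys (f x) (λ y → ∑ xs (λ z → f z y))))

∑-vecsOver : {A : Set} (k : ℕ) (xs : List A) (f : Vec A (suc k) → ℕ) →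
             ∑ (vecsOver (suc k) xs) f ≡ ∑ xs (λ x → ∑ (vecsOver k xs) (λ v → f (x V.∷ v)))
∑-vecsOver k xs f = trans (∑-concatMap xs _ f) (∑-cong xs (λ x → ∑-map (vecsOver k xs) (x V.∷_) f))

∑-vecsOver-1 : {A : Set} (k : ℕ) (xs : List A) → ∑ (vecsOver k xs) (λ _ → 1) ≡ length xs ^ k
∑-vecsOver-1 zero    xs = refl
∑-vecsOver-1 (suc k) xs = begin
  ∑ (vecsOver (suc k) xs) (λ _ → 1)            ≡⟨ ∑-vecsOver k xs _ ⟩
  ∑ xs (λ _ → ∑ (vecsOver k xs) (λ _ → 1))     ≡⟨ ∑-cong xs (λ _ → ∑-vecsOver-1 k xs) ⟩
  ∑ xs (λ _ → length xs ^ k)                    ≡⟨ ∑-const xs (length xs ^ k) ⟩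
  length xs * length xs ^ k                     ∎
  where open ≡-Reasoning

𝟙 : Bool → ℕ
𝟙 true  = 1
𝟙 false = 0

𝟙-∧ : (a b : Bool) → 𝟙 (a ∧ b) ≡ 𝟙 a * 𝟙 b
𝟙-∧ true  b = sym (+-identityʳ (𝟙 b))
𝟙-∧ false b = refl

𝟙-≤ : {a b : Bool} → (T a → T b) → 𝟙 a ≤ 𝟙 b
𝟙-≤ {false}         a⇒b = z≤n
𝟙-≤ {true} {true}  a⇒b = ≤-refl
𝟙-≤ {true} {false} a⇒b = ⊥-elim (a⇒b tt)

𝟙-cong : {a b : Bool} → (T a → T b) → (T b → T a) → 𝟙 a ≡ 𝟙 b
𝟙-cong a⇒b b⇒a = ≤-antisym (𝟙-≤ a⇒b) (𝟙-≤ b⇒a)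

𝟙-true : {a : Bool} → T a → 𝟙 a ≡ 1
𝟙-true {true} _ = refl

𝟙-false : {a : Bool} → ¬ T a → 𝟙 a ≡ 0
𝟙-false {false} _   = refl
𝟙-false {true}  ¬ta = ⊥-elim (¬ta tt)

∑-𝟙-none : {A : Set} (xs : List A) (p : A → Bool) → (∀ x → ¬ T (p x)) → ∑ xs (𝟙 ∘ p) ≡ 0
∑-𝟙-none xs p none = trans (∑-cong xs (λ x → 𝟙-false (none x))) (∑-zero xs)

module _ {A : Set} (_≟_ : DecidableEquality A) where

  δ : A → A → ℕ
  δ x a = 𝟙 ⌊ x ≟ a ⌋

  δ-≡ : {x a : A} → x ≡ a → δ x a ≡ 1
  δ-≡ x≡a = 𝟙-true (fromWitness x≡a)

  δ-refl : (a : A) → δ a a ≡ 1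
  δ-refl a = δ-≡ refl

  δ-≢ : {x a : A} → x ≢ a → δ x a ≡ 0
  δ-≢ x≢a = 𝟙-false (x≢a ∘ toWitness)

  δ-cong : {x a y b : A} → (x ≡ a → y ≡ b) → (y ≡ b → x ≡ a) → δ x a ≡ δ y b
  δ-cong ⇒ ⇐ = 𝟙-cong (fromWitness ∘ ⇒ ∘ toWitness) (fromWitness ∘ ⇐ ∘ toWitness)

  record Enumerates (xs : List A) : Set where
    field
      count≡1 : ∀ a → ∑ xs (λ x → δ x a) ≡ 1

  open Enumerates public

  AtMostOnce : List A → Set
  AtMostOnce xs = ∀ a → ∑ xs (λ x → δ x a) ≤ 1

  module _ {xs : List A} (enum : Enumerates xs) where

    ∑-δ : (a : A) (g : A → ℕ) → ∑ xs (λ x → δ x a * g x) ≡ g a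
    ∑-δ a g = begin
      ∑ xs (λ x → δ x a * g x) ≡⟨ ∑-cong xs sift ⟩
      ∑ xs (λ x → δ x a * g a) ≡⟨ ∑-*ʳ xs (g a) _ ⟩
      ∑ xs (λ x → δ x a) * g a ≡⟨ cong (_* g a) (count≡1 enum a) ⟩
      1 * g a                  ≡⟨ *-identityˡ (g a) ⟩
      g a                      ∎
      where
      open ≡-Reasoning
      sift : ∀ x → δ x a * g x ≡ δ x a * g a
      sift x with x ≟ a
      ... | yes refl = refl
      ... | no _     = refl

    ∑-𝟙-unique : (p : A → Bool) (a : A) → T (p a) → (∀ x → T (p x) → x ≡ a) → ∑ xs (𝟙 ∘ p) ≡ 1
    ∑-𝟙-unique p a pa unique = trans (∑-cong xs p≗δa) (count≡1 enum a)
      where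
      p≗δa : ∀ x → 𝟙 (p x) ≡ δ x a
      p≗δa x with x ≟ a
      ... | yes refl = 𝟙-true pa
      ... | no x≢a   = 𝟙-false (λ px → x≢a (unique x px))

    enumerates⇒∈ : (a : A) → a ∈ xs
    enumerates⇒∈ a = go xs (count≡1 enum a)
      where
      go : (ys : List A) → ∑ ys (λ y → δ y a) ≡ 1 → a ∈ ys
      go (y ∷ ys) count with y ≟ a
      ... | yes refl = here refl
      ... | no _     = there (go ys count)

    enumerates⇒atMostOnce : AtMostOnce xs
    enumerates⇒atMostOnce a = ≤-reflexive (count≡1 enum a)

    ∑-reindex : (τ σ : A → A) → (∀ x → σ (τ x) ≡ x) → (∀ x → τ (σ x) ≡ x) → (f : A → ℕ) → ∑ xs (f ∘ τ) ≡ ∑ xs f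
    ∑-reindex τ σ στ τσ f = begin
      ∑ xs (f ∘ τ)                                   ≡⟨ ∑-cong xs (λ x → sym (∑-δ (τ x) f)) ⟩
      ∑ xs (λ x → ∑ xs (λ w → δ w (τ x) * f w))      ≡⟨ ∑-comm xs xs _ ⟩
      ∑ xs (λ w → ∑ xs (λ x → δ w (τ x) * f w))      ≡⟨ ∑-cong xs (λ w → ∑-*ʳ xs (f w) _) ⟩
      ∑ xs (λ w → ∑ xs (λ x → δ w (τ x)) * f w)      ≡⟨ ∑-cong xs (λ w → cong (_* f w) (trans (∑-cong xs (δ-inverse w)) (count≡1 enum (σ w)))) ⟩
      ∑ xs (λ w → 1 * f w)                           ≡⟨ ∑-cong xs (λ w → *-identityˡ (f w)) ⟩
      ∑ xs f                                         ∎
      where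
      open ≡-Reasoning
      δ-inverse : ∀ w x → δ w (τ x) ≡ δ x (σ w)
      δ-inverse w x = δ-cong (λ w≡τx → trans (sym (στ x)) (cong σ (sym w≡τx))) (λ x≡σw → trans (sym (τσ w)) (cong τ (sym x≡σw)))

    enumerates-flip : (a : A) → ∑ xs (δ a) ≡ 1
    enumerates-flip a = trans (∑-cong xs (λ x → δ-cong sym sym)) (count≡1 enum a)

    𝟙-any : (p : A → Bool) → (∀ x y → T (p x) → T (p y) → x ≡ y) → 𝟙 (any p xs) ≡ ∑ xs (𝟙 ∘ p)
    𝟙-any p unique with T? (any p xs)
    ... | yes t = let (a , pa) = any-elim p xs t in
      trans (𝟙-true t) (sym (∑-𝟙-unique p a pa (λ x px → unique x a px pa)))
    ... | no ¬t = trans (𝟙-false ¬t) (sym (∑-𝟙-none xs p (λ x px → ¬t (any-intro enumerates⇒∈ p x px))))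

  atMostOnce-tail : (x : A) (xs : List A) → AtMostOnce (x ∷ xs) → AtMostOnce xs
  atMostOnce-tail x xs once a = ≤-trans (m≤n+m _ (δ x a)) (once a)

  atMostOnce-head∉ : (x : A) (xs : List A) → AtMostOnce (x ∷ xs) → x ∈ xs → ⊥
  atMostOnce-head∉ x xs once x∈xs = 1+n≰n (≤-trans (+-monoʳ-≤ 1 (positive xs x∈xs)) bound)
    where
    bound : 1 + ∑ xs (λ y → δ y x) ≤ 1
    bound = subst (λ c → c + ∑ xs (λ y → δ y x) ≤ 1) (δ-refl x) (once x)
    positive : (ys : List A) → x ∈ ys → 1 ≤ ∑ ys (λ y → δ y x)
    positive (y ∷ ys) (here refl) = ≤-trans (≤-reflexive (sym (δ-refl y))) (m≤m+n _ _)
    positive (y ∷ ys) (there x∈ys) = ≤-trans (positive ys x∈ys) (m≤n+m _ _)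

  unique⇒enumerates : {xs : List A} → Unique xs → (∀ a → a ∈ xs) → Enumerates xs
  unique⇒enumerates {xs} unique complete .count≡1 a = go xs unique (complete a)
    where
    absent : {x : A} (ys : List A) → All.All (x ≢_) ys → ∑ ys (λ y → δ y x) ≡ 0
    absent []       []             = refl
    absent (y ∷ ys) (x≢y ∷ x∉ys) = cong₂ _+_ (δ-≢ (x≢y ∘ sym)) (absent ys x∉ys)
    go : (ys : List A) → Unique ys → a ∈ ys → ∑ ys (λ y → δ y a) ≡ 1
    go (y ∷ ys) (y∉ys ∷ _)      (here refl)  = cong₂ _+_ (δ-refl y) (absent ys y∉ys)
    go (y ∷ ys) (y∉ys ∷ unique) (there a∈ys) = cong₂ _+_ (δ-≢ (All.lookup y∉ys a∈ys)) (go ys unique a∈ys)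

module _ {A : Set} (_≟_ : DecidableEquality A) where

  δ-∷ : {k : ℕ} (x a : A) (v w : Vec A k) → δ (≡-dec _≟_) (x V.∷ v) (a V.∷ w) ≡ δ _≟_ x a * δ (≡-dec _≟_) v w
  δ-∷ x a v w = split x a v w (x ≟ a) (≡-dec _≟_ v w)
    where
    δᵥ : {k : ℕ} → Vec A k → Vec A k → ℕ
    δᵥ = δ (≡-dec _≟_)
    split : {k : ℕ} (x a : A) (v w : Vec A k) → Dec (x ≡ a) → Dec (v ≡ w) → δᵥ (x V.∷ v) (a V.∷ w) ≡ δ _≟_ x a * δᵥ v w
    split x .x v .v (yes refl) (yes refl) =
      trans (δ-refl (≡-dec _≟_) (x V.∷ v)) (sym (cong₂ _*_ (δ-refl _≟_ x) (δ-refl (≡-dec _≟_) v)))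
    split x .x v w  (yes refl) (no v≢w)  =
      trans (δ-≢ (≡-dec _≟_) (v≢w ∘ ∷-injectiveʳ)) (sym (trans (cong (δ _≟_ x x *_) (δ-≢ (≡-dec _≟_) v≢w)) (*-zeroʳ (δ _≟_ x x))))
    split x a v w  (no x≢a)   _          =
      trans (δ-≢ (≡-dec _≟_) (x≢a ∘ ∷-injectiveˡ)) (sym (cong (_* δᵥ v w) (δ-≢ _≟_ x≢a)))

  vecsOver-enumerates : {xs : List A} → Enumerates _≟_ xs → (k : ℕ) → Enumerates (≡-dec _≟_) (vecsOver k xs)
  vecsOver-enumerates enum zero    .count≡1 V.[]      = refl
  vecsOver-enumerates {xs} enum (suc k) .count≡1 (a V.∷ w) = begin
    ∑ (vecsOver (suc k) xs) (λ v → δ (≡-dec _≟_) v (a V.∷ w))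
      ≡⟨ ∑-vecsOver k xs _ ⟩
    ∑ xs (λ x → ∑ (vecsOver k xs) (λ v → δ (≡-dec _≟_) (x V.∷ v) (a V.∷ w)))
      ≡⟨ ∑-cong xs (λ x → ∑-cong (vecsOver k xs) (λ v → δ-∷ x a v w)) ⟩
    ∑ xs (λ x → ∑ (vecsOver k xs) (λ v → δ _≟_ x a * δ (≡-dec _≟_) v w))
      ≡⟨ ∑-cong xs (λ x → ∑-*ˡ (vecsOver k xs) (δ _≟_ x a) _) ⟩
    ∑ xs (λ x → δ _≟_ x a * ∑ (vecsOver k xs) (λ v → δ (≡-dec _≟_) v w))
      ≡⟨ ∑-cong xs (λ x → cong (δ _≟_ x a *_) (count≡1 (vecsOver-enumerates enum k) w)) ⟩
    ∑ xs (λ x → δ _≟_ x a * 1)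
      ≡⟨ ∑-cong xs (λ x → *-identityʳ _) ⟩
    ∑ xs (λ x → δ _≟_ x a)
      ≡⟨ count≡1 enum a ⟩
    1 ∎
    where open ≡-Reasoning

booleans-enumerate : Enumerates Bool._≟_ (true ∷ false ∷ [])
booleans-enumerate .count≡1 true  = refl
booleans-enumerate .count≡1 false = refl

module _ {m : ℕ} (1<m : 1 < m) where

  ^-cancelˡ-≤ : (a b : ℕ) → m ^ a ≤ m ^ b → a ≤ b
  ^-cancelˡ-≤ a b m^a≤m^b with ≤-<-connex a b
  ... | inj₁ a≤b = a≤b
  ... | inj₂ b<a = ⊥-elim (<⇒≱ (^-monoʳ-< m 1<m b<a) m^a≤m^b)

  ^-injectiveʳ : (a b : ℕ) → m ^ a ≡ m ^ b → a ≡ b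
  ^-injectiveʳ a b eq = ≤-antisym (^-cancelˡ-≤ a b (≤-reflexive eq)) (^-cancelˡ-≤ b a (≤-reflexive (sym eq)))

*-cancel-factor : (a c d b : ℕ) → .{{NonZero a}} → c * (d * a) + a ≡ a * b → c * d + 1 ≡ b
*-cancel-factor a c d b eq = *-cancelˡ-≡ (c * d + 1) b a (trans (distribute a c d) eq)
  where
  distribute : ∀ a c d → a * (c * d + 1) ≡ c * (d * a) + a
  distribute = solve 3 (λ a c d → a :* (c :* d :+ con 1) := c :* (d :* a) :+ a) refl
    where open ℕSolver.+-*-Solver

*-cancel-factors : (a p r s h d : ℕ) → .{{NonZero a}} → .{{NonZero p}} → h * (a * p) ≡ s → s * d ≡ a * r * p → h * d ≡ r
*-cancel-factors a p r s h d h*ap≡s s*d≡arp = *-cancelˡ-≡ (h * d) r (a * p) {{m*n≢0 a p}} (begin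
  a * p * (h * d)    ≡⟨ solve 4 (λ a p h d → a :* p :* (h :* d) := h :* (a :* p) :* d) refl a p h d ⟩
  h * (a * p) * d    ≡⟨ cong (_* d) h*ap≡s ⟩
  s * d              ≡⟨ s*d≡arp ⟩
  a * r * p          ≡⟨ solve 3 (λ a r p → a :* r :* p := a :* p :* r) refl a r p ⟩
  a * p * r          ∎)
  where
  open ≡-Reasoning
  open ℕSolver.+-*-Solver

ℕ→ℚ≡mkℚ : (n : ℕ) → ℕ→ℚ n ≡ mkℚ (ℤ.+ n) 0 (Coprimality.sym (1-coprimeTo n))
ℕ→ℚ≡mkℚ n = ℚP.↥p/↧p≡p (mkℚ (ℤ.+ n) 0 (Coprimality.sym (1-coprimeTo n)))

ℕ→ℚ-+ : (a b : ℕ) → ℕ→ℚ (a + b) ≡ ℕ→ℚ a Q.+ ℕ→ℚ b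
ℕ→ℚ-+ a b = trans (cong (Q._/ 1) numerator) (sym (cong₂ Q._+_ (ℕ→ℚ≡mkℚ a) (ℕ→ℚ≡mkℚ b)))
  where
  numerator : ℤ.+ (a + b) ≡ (ℤ.+ a ℤ.* ℤ.+ 1) ℤ.+ (ℤ.+ b ℤ.* ℤ.+ 1)
  numerator = trans (ℤP.pos-+ a b) (sym (cong₂ ℤ._+_ (ℤP.*-identityʳ (ℤ.+ a)) (ℤP.*-identityʳ (ℤ.+ b))))

ℕ→ℚ-* : (a b : ℕ) → ℕ→ℚ (a * b) ≡ ℕ→ℚ a Q.* ℕ→ℚ b
ℕ→ℚ-* a b = trans (cong (Q._/ 1) (ℤP.pos-* a b)) (sym (cong₂ Q._*_ (ℕ→ℚ≡mkℚ a) (ℕ→ℚ≡mkℚ b)))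

inv-inverseˡ : (n : ℕ) → .{{NonZero n}} → inv n Q.* ℕ→ℚ n ≡ 1ℚ
inv-inverseˡ (suc n) = trans (cong₂ Q._*_ inv≡1/ (ℕ→ℚ≡mkℚ (suc n))) (ℚP.*-inverseˡ (mkℚ (ℤ.+ suc n) 0 (Coprimality.sym (1-coprimeTo (suc n)))))
  where
  inv≡1/ : inv (suc n) ≡ Q.1/ (mkℚ (ℤ.+ suc n) 0 (Coprimality.sym (1-coprimeTo (suc n))))
  inv≡1/ = ℚP.↥p/↧p≡p (mkℚ (ℤ.+ 1) n (1-coprimeTo (suc n)))

ℕ→ℚ-*+* : (a b c e : ℕ) → ℕ→ℚ (a * b + c * e) ≡ ℕ→ℚ a Q.* ℕ→ℚ b Q.+ ℕ→ℚ c Q.* ℕ→ℚ e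
ℕ→ℚ-*+* a b c e = trans (ℕ→ℚ-+ (a * b) (c * e)) (cong₂ Q._+_ (ℕ→ℚ-* a b) (ℕ→ℚ-* c e))

ℕ→ℚ-∸1 : (n : ℕ) → .{{NonZero n}} → ℕ→ℚ n Q.- 1ℚ ≡ ℕ→ℚ (n ∸ 1)
ℕ→ℚ-∸1 (suc n) = begin
  ℕ→ℚ (1 + n) Q.- 1ℚ          ≡⟨ cong (Q._- 1ℚ) (ℕ→ℚ-+ 1 n) ⟩
  (1ℚ Q.+ ℕ→ℚ n) Q.- 1ℚ       ≡⟨ solve 1 (λ x → (con 1ℚ :+ x) :- con 1ℚ := x) refl (ℕ→ℚ n) ⟩
  ℕ→ℚ n                       ∎
  where
  open ≡-Reasoning
  open QSolver.+-*-Solver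

∑ℚ : {A : Set} → List A → (A → ℚ) → ℚ
∑ℚ xs f = Data.List.foldr Q._+_ 0ℚ (map f xs)

module _ {A : Set} where

  ∑ℚ-cong : (xs : List A) {f g : A → ℚ} → (∀ x → f x ≡ g x) → ∑ℚ xs f ≡ ∑ℚ xs g
  ∑ℚ-cong []       f≗g = refl
  ∑ℚ-cong (x ∷ xs) f≗g = cong₂ Q._+_ (f≗g x) (∑ℚ-cong xs f≗g)

  ∑ℚ-ℕ→ℚ : (xs : List A) (f : A → ℕ) → ∑ℚ xs (ℕ→ℚ ∘ f) ≡ ℕ→ℚ (∑ xs f)
  ∑ℚ-ℕ→ℚ []       f = refl
  ∑ℚ-ℕ→ℚ (x ∷ xs) f = trans (cong (ℕ→ℚ (f x) Q.+_) (∑ℚ-ℕ→ℚ xs f)) (sym (ℕ→ℚ-+ (f x) (∑ xs f)))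

  ∑ℚ-*ˡ : (xs : List A) (c : ℚ) (f : A → ℚ) → ∑ℚ xs (λ x → c Q.* f x) ≡ c Q.* ∑ℚ xs f
  ∑ℚ-*ˡ []       c f = sym (ℚP.*-zeroʳ c)
  ∑ℚ-*ˡ (x ∷ xs) c f = trans (cong (c Q.* f x Q.+_) (∑ℚ-*ˡ xs c f)) (sym (ℚP.*-distribˡ-+ c (f x) (∑ℚ xs f)))

module _ where
  open QSolver.+-*-Solver
  open Q using () renaming (_+_ to _+ℚ_; _*_ to _*ℚ_; _-_ to _-ℚ_)

  private
    isolate : {a b c : ℚ} → a +ℚ b ≡ c → a ≡ c -ℚ b
    isolate {a} {b} a+b≡c = trans (solve 2 (λ a b → a := (a :+ b) :- b) refl a b) (cong (_-ℚ b) a+b≡c)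

  cancel-multiplier : (x u v t s p k : ℚ) → k *ℚ p ≡ 1ℚ → p *ℚ x +ℚ u *ℚ t ≡ v *ℚ t +ℚ p *ℚ s → x ≡ ((v -ℚ u) *ℚ k) *ℚ t +ℚ s
  cancel-multiplier x u v t s p k k*p≡1 eq = begin
    x                                          ≡⟨ sym (ℚP.*-identityʳ x) ⟩
    x *ℚ 1ℚ                                    ≡⟨ cong (x *ℚ_) (sym k*p≡1) ⟩
    x *ℚ (k *ℚ p)                              ≡⟨ solve 3 (λ x k p → x :* (k :* p) := k :* (p :* x)) refl x k p ⟩
    k *ℚ (p *ℚ x)                              ≡⟨ cong (k *ℚ_) (isolate eq) ⟩
    k *ℚ ((v *ℚ t +ℚ p *ℚ s) -ℚ u *ℚ t)
      ≡⟨ solve 6 (λ u v t s p k → k :* ((v :* t :+ p :* s) :- u :* t) := ((v :- u) :* k) :* t :+ s :* (k :* p)) refl u v t s p k ⟩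
    ((v -ℚ u) *ℚ k) *ℚ t +ℚ s *ℚ (k *ℚ p)      ≡⟨ cong (λ r → ((v -ℚ u) *ℚ k) *ℚ t +ℚ s *ℚ r) k*p≡1 ⟩
    ((v -ℚ u) *ℚ k) *ℚ t +ℚ s *ℚ 1ℚ            ≡⟨ cong (((v -ℚ u) *ℚ k) *ℚ t +ℚ_) (ℚP.*-identityʳ s) ⟩
    ((v -ℚ u) *ℚ k) *ℚ t +ℚ s                  ∎
    where open ≡-Reasoning

  cancel-multipliers : (kd ki k Pd Pi P t s : ℚ) → kd *ℚ Pd ≡ 1ℚ → ki *ℚ Pi ≡ 1ℚ → k *ℚ P ≡ 1ℚ →
                       Pi *ℚ P *ℚ t +ℚ (P -ℚ 1ℚ) *ℚ Pd *ℚ s ≡ Pd *ℚ P *ℚ t → kd *ℚ t ≡ ki *ℚ t +ℚ ((k -ℚ 1ℚ) *ℚ ki) *ℚ s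
  cancel-multipliers kd ki k Pd Pi P t s kd*Pd≡1 ki*Pi≡1 k*P≡1 eq = begin
    kd *ℚ t                                         ≡⟨ solve 2 (λ kd t → kd :* t := kd :* t :* con 1ℚ :* con 1ℚ) refl kd t ⟩
    kd *ℚ t *ℚ 1ℚ *ℚ 1ℚ                             ≡⟨ cong₂ (λ a b → kd *ℚ t *ℚ a *ℚ b) (sym ki*Pi≡1) (sym k*P≡1) ⟩
    kd *ℚ t *ℚ (ki *ℚ Pi) *ℚ (k *ℚ P)
      ≡⟨ solve 6 (λ kd ki k Pi P t → kd :* t :* (ki :* Pi) :* (k :* P) := kd :* ki :* k :* (Pi :* P :* t)) refl kd ki k Pi P t ⟩
    kd *ℚ ki *ℚ k *ℚ (Pi *ℚ P *ℚ t)                 ≡⟨ cong (kd *ℚ ki *ℚ k *ℚ_) (isolate eq) ⟩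
    kd *ℚ ki *ℚ k *ℚ (Pd *ℚ P *ℚ t -ℚ (P -ℚ 1ℚ) *ℚ Pd *ℚ s)
      ≡⟨ solve 8 (λ kd ki k Pd P t s o → kd :* ki :* k :* (Pd :* P :* t :- (P :- o) :* Pd :* s)
                                         := (kd :* Pd) :* (k :* P) :* ki :* t :- (kd :* Pd) :* ki :* ((k :* P) :- k :* o) :* s)
                 refl kd ki k Pd P t s 1ℚ ⟩
    (kd *ℚ Pd) *ℚ (k *ℚ P) *ℚ ki *ℚ t -ℚ (kd *ℚ Pd) *ℚ ki *ℚ ((k *ℚ P) -ℚ k *ℚ 1ℚ) *ℚ s
      ≡⟨ cong₂ (λ a b → a *ℚ b *ℚ ki *ℚ t -ℚ a *ℚ ki *ℚ (b -ℚ k *ℚ 1ℚ) *ℚ s) kd*Pd≡1 k*P≡1 ⟩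
    1ℚ *ℚ 1ℚ *ℚ ki *ℚ t -ℚ 1ℚ *ℚ ki *ℚ (1ℚ -ℚ k *ℚ 1ℚ) *ℚ s
      ≡⟨ solve 4 (λ ki k t s → con 1ℚ :* con 1ℚ :* ki :* t :- con 1ℚ :* ki :* (con 1ℚ :- k :* con 1ℚ) :* s
                              := ki :* t :+ ((k :- con 1ℚ) :* ki) :* s) refl ki k t s ⟩
    ki *ℚ t +ℚ ((k -ℚ 1ℚ) *ℚ ki) *ℚ s               ∎
    where open ≡-Reasoning

module Subspaces (𝔽 : FiniteField) (N : ℕ) where

  open FiniteField 𝔽
  open Setting 𝔽 N
  module R = IsCommutativeRing isCommutativeRing

  ring : Ring 0ℓ 0ℓ
  ring = record { isRing = R.isRing }

  module RingF = RingProperties ring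
  module AdditiveF = AbelianGroupProperties (Ring.+-abelianGroup ring)

  elements-enumerate : Enumerates _≟F_ elements
  elements-enumerate = unique⇒enumerates _≟F_ elements-unique elements-complete

  coefficients-enumerate : (k : ℕ) → Enumerates (≡-dec _≟F_) (vecsOver k elements)
  coefficients-enumerate = vecsOver-enumerates _≟F_ elements-enumerate

  allVecs-enumerate : Enumerates _≟v_ allVecs
  allVecs-enumerate = coefficients-enumerate N

  coefficients-complete : (k : ℕ) (c : Vec F k) → c ∈ vecsOver k elements
  coefficients-complete k = enumerates⇒∈ (≡-dec _≟F_) (coefficients-enumerate k)

  allVecs-complete : (v : Vect) → v ∈ allVecs
  allVecs-complete = coefficients-complete N

  1<q : 1 < q
  1<q = begin
    2                                        ≡⟨ sym (cong₂ _+_ (count≡1 elements-enumerate 0F) (count≡1 elements-enumerate 1F)) ⟩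
    ∑ elements (λ x → δ _≟F_ x 0F) + ∑ elements (λ x → δ _≟F_ x 1F)
                                             ≡⟨ sym (∑-distrib-+ elements _ _) ⟩
    ∑ elements (λ x → δ _≟F_ x 0F + δ _≟F_ x 1F) ≤⟨ ∑-mono-≤ elements at-most-one ⟩
    ∑ elements (λ _ → 1)                     ≡⟨ trans (∑-const elements 1) (*-identityʳ q) ⟩
    q                                        ∎
    where
    open ≤-Reasoning
    at-most-one : ∀ x → δ _≟F_ x 0F + δ _≟F_ x 1F ≤ 1
    at-most-one x with x ≟F 0F | x ≟F 1F
    ... | yes refl | yes 0≡1 = ⊥-elim (0≢1 0≡1)
    ... | yes _    | no _    = ≤-refl
    ... | no _     | yes _   = ≤-refl
    ... | no _     | no _    = z≤n

  instance
    q-nonZero : NonZero q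
    q-nonZero = ℕ.>-nonZero (<-trans (s≤s z≤n) 1<q)

  q^-nonZero : (n : ℕ) → NonZero (q ^ n)
  q^-nonZero n = m^n≢0 q n

  q-1 : ℕ
  q-1 = q ∸ 1

  q≡1+[q-1] : q ≡ suc q-1
  q≡1+[q-1] = sym (m+[n∸m]≡n (<-trans (s≤s z≤n) 1<q))

  q-1≢0 : q-1 ≢ 0
  q-1≢0 q-1≡0 = <-irrefl (sym (trans q≡1+[q-1] (cong suc q-1≡0))) 1<q

  -- At length N these are, definitionally, the _+v_, _·v_ and zeroV of Defs.
  infixl 6 _⊞_ _⊟_
  infixr 8 _⊡_
  infixr 7 ⊝_

  _⊞_ : {n : ℕ} → Vec F n → Vec F n → Vec F n
  _⊞_ = V.zipWith _⊕_

  _⊡_ : {n : ℕ} → F → Vec F n → Vec F n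
  c ⊡ u = V.map (c ⊗_) u

  𝟎 : {n : ℕ} → Vec F n
  𝟎 {n} = V.replicate n 0F

  ⊝_ : {n : ℕ} → Vec F n → Vec F n
  ⊝ u = (⊖ 1F) ⊡ u

  _⊟_ : {n : ℕ} → Vec F n → Vec F n → Vec F n
  u ⊟ w = u ⊞ ⊝ w

  ⊡-zeroˡ : {n : ℕ} (u : Vec F n) → 0F ⊡ u ≡ 𝟎
  ⊡-zeroˡ u = trans (map-cong R.zeroˡ u) (map-const u 0F)

  ⊡-zeroʳ : {n : ℕ} (c : F) → c ⊡ 𝟎 ≡ 𝟎 {n}
  ⊡-zeroʳ {n} c = trans (map-replicate (c ⊗_) 0F n) (cong (V.replicate n) (R.zeroʳ c))

  ⊡-identityˡ : {n : ℕ} (u : Vec F n) → 1F ⊡ u ≡ u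
  ⊡-identityˡ u = trans (map-cong R.*-identityˡ u) (map-id u)

  ⊡-assoc : {n : ℕ} (a b : F) (u : Vec F n) → (a ⊗ b) ⊡ u ≡ a ⊡ b ⊡ u
  ⊡-assoc a b u = trans (map-cong (R.*-assoc a b) u) (map-∘ (a ⊗_) (b ⊗_) u)

  ⊡-distribʳ : {n : ℕ} (a b : F) (u : Vec F n) → (a ⊕ b) ⊡ u ≡ a ⊡ u ⊞ b ⊡ u
  ⊡-distribʳ a b V.[]      = refl
  ⊡-distribʳ a b (c V.∷ u) = cong₂ V._∷_ (R.distribʳ c a b) (⊡-distribʳ a b u)

  ⊡-distribˡ : {n : ℕ} (a : F) (u w : Vec F n) → a ⊡ (u ⊞ w) ≡ a ⊡ u ⊞ a ⊡ w
  ⊡-distribˡ a V.[]      V.[]      = refl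
  ⊡-distribˡ a (b V.∷ u) (c V.∷ w) = cong₂ V._∷_ (R.distribˡ a b c) (⊡-distribˡ a u w)

  ⊡-comm : {n : ℕ} (a b : F) (u : Vec F n) → a ⊡ b ⊡ u ≡ b ⊡ a ⊡ u
  ⊡-comm a b u = trans (sym (⊡-assoc a b u)) (trans (cong (_⊡ u) (R.*-comm a b)) (⊡-assoc b a u))

  ⊞-inverseʳ : {n : ℕ} (u : Vec F n) → u ⊟ u ≡ 𝟎
  ⊞-inverseʳ V.[]      = refl
  ⊞-inverseʳ (a V.∷ u) = cong₂ V._∷_ a-a≡0 (⊞-inverseʳ u)
    where
    a-a≡0 : a ⊕ ((⊖ 1F) ⊗ a) ≡ 0F
    a-a≡0 = trans (cong (a ⊕_) (RingF.-1*x≈-x a)) (R.-‿inverseʳ a)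

  module _ {n : ℕ} where

    ⊞-abelianGroup : AbelianGroup 0ℓ 0ℓ
    ⊞-abelianGroup = record
      { Carrier        = Vec F n
      ; _∙_            = _⊞_
      ; ε              = 𝟎
      ; _⁻¹            = ⊝_
      ; isAbelianGroup = record
        { isGroup = record
          { isMonoid = record
            { isSemigroup = record { isMagma = isMagma _⊞_ ; assoc = zipWith-assoc R.+-assoc }
            ; identity    = zipWith-identityˡ R.+-identityˡ , zipWith-identityʳ R.+-identityʳ
            }
          ; inverse = (λ u → trans (zipWith-comm R.+-comm (⊝ u) u) (⊞-inverseʳ u)) , ⊞-inverseʳ
          ; ⁻¹-cong = cong ⊝_
          }
        ; comm = zipWith-comm R.+-comm
        }
      }

    open AbelianGroup ⊞-abelianGroup public
      using () renaming (assoc to ⊞-assoc; comm to ⊞-comm; identityˡ to ⊞-identityˡ; identityʳ to ⊞-identityʳ)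
    open AbelianGroupProperties ⊞-abelianGroup public
      using (⁻¹-∙-comm; //-rightDividesˡ; //-rightDividesʳ; x∙y⁻¹≈ε⇒x≈y; ⁻¹-involutive)
    open CommutativeSemigroupProperties (AbelianGroup.commutativeSemigroup ⊞-abelianGroup) public
      using (interchange)

  ⊟-identityʳ : {n : ℕ} (u : Vec F n) → u ⊟ 𝟎 ≡ u
  ⊟-identityʳ u = trans (cong (u ⊞_) (⊡-zeroʳ (⊖ 1F))) (⊞-identityʳ u)

  ⊟⊡-⊞ : {n : ℕ} (u₁ u₂ v : Vec F n) (a b : F) → (u₁ ⊟ a ⊡ v) ⊞ (u₂ ⊟ b ⊡ v) ≡ (u₁ ⊞ u₂) ⊟ (a ⊕ b) ⊡ v
  ⊟⊡-⊞ u₁ u₂ v a b = begin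
    (u₁ ⊞ ⊝ a ⊡ v) ⊞ (u₂ ⊞ ⊝ b ⊡ v)   ≡⟨ interchange u₁ _ u₂ _ ⟩
    (u₁ ⊞ u₂) ⊞ (⊝ a ⊡ v ⊞ ⊝ b ⊡ v)   ≡⟨ cong ((u₁ ⊞ u₂) ⊞_) (⁻¹-∙-comm (a ⊡ v) (b ⊡ v)) ⟩
    (u₁ ⊞ u₂) ⊟ (a ⊡ v ⊞ b ⊡ v)       ≡⟨ cong (λ w → (u₁ ⊞ u₂) ⊟ w) (sym (⊡-distribʳ a b v)) ⟩
    (u₁ ⊞ u₂) ⊟ (a ⊕ b) ⊡ v           ∎
    where open ≡-Reasoning

  ⊡-⊟⊡ : {n : ℕ} (c a : F) (u v : Vec F n) → c ⊡ (u ⊟ a ⊡ v) ≡ c ⊡ u ⊟ (c ⊗ a) ⊡ v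
  ⊡-⊟⊡ c a u v = begin
    c ⊡ (u ⊞ ⊝ a ⊡ v)       ≡⟨ ⊡-distribˡ c u _ ⟩
    c ⊡ u ⊞ c ⊡ (⊝ a ⊡ v)   ≡⟨ cong (c ⊡ u ⊞_) (⊡-comm c (⊖ 1F) (a ⊡ v)) ⟩
    c ⊡ u ⊞ ⊝ c ⊡ a ⊡ v     ≡⟨ cong (λ w → c ⊡ u ⊟ w) (sym (⊡-assoc c a v)) ⟩
    c ⊡ u ⊟ (c ⊗ a) ⊡ v     ∎
    where open ≡-Reasoning

  ⊟⊡-⊟ : {n : ℕ} (u v : Vec F n) (c d : F) → (u ⊟ d ⊡ v) ⊟ (u ⊟ c ⊡ v) ≡ (c ⊕ ((⊖ 1F) ⊗ d)) ⊡ v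
  ⊟⊡-⊟ u v c d = begin
    (u ⊞ ⊝ d ⊡ v) ⊞ ⊝ (u ⊞ ⊝ c ⊡ v)         ≡⟨ cong ((u ⊞ ⊝ d ⊡ v) ⊞_) (sym (⁻¹-∙-comm u (⊝ c ⊡ v))) ⟩
    (u ⊞ ⊝ d ⊡ v) ⊞ (⊝ u ⊞ ⊝ ⊝ c ⊡ v)       ≡⟨ cong (λ w → (u ⊞ ⊝ d ⊡ v) ⊞ (⊝ u ⊞ w)) (⁻¹-involutive (c ⊡ v)) ⟩
    (u ⊞ ⊝ d ⊡ v) ⊞ (⊝ u ⊞ c ⊡ v)           ≡⟨ interchange u _ (⊝ u) _ ⟩
    (u ⊟ u) ⊞ (⊝ d ⊡ v ⊞ c ⊡ v)             ≡⟨ cong (_⊞ (⊝ d ⊡ v ⊞ c ⊡ v)) (⊞-inverseʳ u) ⟩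
    𝟎 ⊞ (⊝ d ⊡ v ⊞ c ⊡ v)                   ≡⟨ ⊞-identityˡ _ ⟩
    ⊝ d ⊡ v ⊞ c ⊡ v                          ≡⟨ ⊞-comm _ _ ⟩
    c ⊡ v ⊞ ⊝ d ⊡ v                          ≡⟨ cong (c ⊡ v ⊞_) (sym (⊡-assoc (⊖ 1F) d v)) ⟩
    c ⊡ v ⊞ ((⊖ 1F) ⊗ d) ⊡ v                 ≡⟨ sym (⊡-distribʳ c _ v) ⟩
    (c ⊕ ((⊖ 1F) ⊗ d)) ⊡ v                   ∎
    where open ≡-Reasoning

  _⊆_ : (Vect → Bool) → (Vect → Bool) → Set
  a ⊆ b = ∀ u → T (a u) → T (b u)

  IsSubspace : (Vect → Bool) → Set
  IsSubspace m = T (isSubspaceB m)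

  module _ {m : Vect → Bool} (subspace : IsSubspace m) where

    private
      closure : T (m zeroV) × T (all (λ u → all (λ v → not (m u ∧ m v) ∨ m (u +v v)) allVecs) allVecs)
                            × T (all (λ c → all (λ u → not (m u) ∨ m (c ·v u)) allVecs) elements)
      closure = let (z , rest) = ∧-elim {m zeroV} subspace in z , ∧-elim rest

    subspace-𝟎 : T (m 𝟎)
    subspace-𝟎 = proj₁ closure

    subspace-⊞ : ∀ u v → T (m u) → T (m v) → T (m (u ⊞ v))
    subspace-⊞ u v mu mv =
      ⇒-elim {m u ∧ m v} (all-elim allVecs-complete _ (all-elim allVecs-complete _ (proj₁ (proj₂ closure)) u) v) (∧-intro mu mv)

    subspace-⊡ : ∀ c u → T (m u) → T (m (c ⊡ u))
    subspace-⊡ c u mu = ⇒-elim {m u} (all-elim allVecs-complete _ (all-elim elements-complete _ (proj₂ (proj₂ closure)) c) u) mu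

    subspace-⊟ : ∀ u v → T (m u) → T (m v) → T (m (u ⊟ v))
    subspace-⊟ u v mu mv = subspace-⊞ u (⊝ v) mu (subspace-⊡ (⊖ 1F) v mv)

  isSubspace-intro : (m : Vect → Bool) → T (m 𝟎) → (∀ u v → T (m u) → T (m v) → T (m (u ⊞ v))) →
                     (∀ c u → T (m u) → T (m (c ⊡ u))) → IsSubspace m
  isSubspace-intro m m𝟎 m⊞ m⊡ = ∧-intro m𝟎 (∧-intro
    (all-intro allVecs-complete _ (λ u → all-intro allVecs-complete _ (λ v → ⇒-intro {m u ∧ m v} (λ muv →
      let (mu , mv) = ∧-elim {m u} muv in m⊞ u v mu mv))))
    (all-intro elements-complete _ (λ c → all-intro allVecs-complete _ (λ u → ⇒-intro {m u} (m⊡ c u)))))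

  ∈-𝟎 : (y : X) → T (mem y 𝟎)
  ∈-𝟎 y = subspace-𝟎 {mem y} (proj₂ y)

  ∈-⊞ : (y : X) → ∀ u v → T (mem y u) → T (mem y v) → T (mem y (u ⊞ v))
  ∈-⊞ y = subspace-⊞ {mem y} (proj₂ y)

  ∈-⊡ : (y : X) → ∀ c u → T (mem y u) → T (mem y (c ⊡ u))
  ∈-⊡ y = subspace-⊡ {mem y} (proj₂ y)

  ∈-⊟ : (y : X) → ∀ u v → T (mem y u) → T (mem y v) → T (mem y (u ⊟ v))
  ∈-⊟ y = subspace-⊟ {mem y} (proj₂ y)

  ∣_∣ : (Vect → Bool) → ℕ
  ∣ m ∣ = ∑ allVecs (𝟙 ∘ m)

  ∑-translate : (a : Vect) (f : Vect → ℕ) → ∑ allVecs (λ u → f (u ⊟ a)) ≡ ∑ allVecs f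
  ∑-translate a = ∑-reindex _≟v_ allVecs-enumerate (_⊟ a) (_⊞ a) (λ u → //-rightDividesˡ a u) (λ u → //-rightDividesʳ a u)

  ∣∣≤q^N : (m : Vect → Bool) → ∣ m ∣ ≤ q ^ N
  ∣∣≤q^N m = begin
    ∑ allVecs (𝟙 ∘ m)       ≤⟨ ∑-mono-≤ allVecs (λ u → 𝟙-≤ {m u} {true} _) ⟩
    ∑ allVecs (λ _ → 1)     ≡⟨ ∑-vecsOver-1 N elements ⟩
    q ^ N                   ∎
    where open ≤-Reasoning

  lincomb-⊞ : {k : ℕ} (c d : Vec F k) (vs : Vec Vect k) → lincomb (c ⊞ d) vs ≡ lincomb c vs ⊞ lincomb d vs
  lincomb-⊞ V.[]      V.[]      V.[]       = sym (⊞-identityˡ zeroV)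
  lincomb-⊞ (a V.∷ c) (b V.∷ d) (v V.∷ vs) = begin
    (a ⊕ b) ⊡ v ⊞ lincomb (c ⊞ d) vs                       ≡⟨ cong₂ _⊞_ (⊡-distribʳ a b v) (lincomb-⊞ c d vs) ⟩
    (a ⊡ v ⊞ b ⊡ v) ⊞ (lincomb c vs ⊞ lincomb d vs)       ≡⟨ interchange (a ⊡ v) (b ⊡ v) (lincomb c vs) (lincomb d vs) ⟩
    (a ⊡ v ⊞ lincomb c vs) ⊞ (b ⊡ v ⊞ lincomb d vs)       ∎
    where open ≡-Reasoning

  lincomb-⊡ : {k : ℕ} (a : F) (c : Vec F k) (vs : Vec Vect k) → lincomb (a ⊡ c) vs ≡ a ⊡ lincomb c vs
  lincomb-⊡ a V.[]      V.[]       = sym (⊡-zeroʳ a)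
  lincomb-⊡ a (b V.∷ c) (v V.∷ vs) = begin
    (a ⊗ b) ⊡ v ⊞ lincomb (a ⊡ c) vs       ≡⟨ cong₂ _⊞_ (⊡-assoc a b v) (lincomb-⊡ a c vs) ⟩
    a ⊡ b ⊡ v ⊞ a ⊡ lincomb c vs          ≡⟨ sym (⊡-distribˡ a (b ⊡ v) (lincomb c vs)) ⟩
    a ⊡ (b ⊡ v ⊞ lincomb c vs)            ∎
    where open ≡-Reasoning

  lincomb-⊟ : {k : ℕ} (c d : Vec F k) (vs : Vec Vect k) → lincomb (c ⊟ d) vs ≡ lincomb c vs ⊟ lincomb d vs
  lincomb-⊟ c d vs = trans (lincomb-⊞ c (⊝ d) vs) (cong (lincomb c vs ⊞_) (lincomb-⊡ (⊖ 1F) d vs))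

  AllIn : {k : ℕ} → X → Vec Vect k → Set
  AllIn y vs = T (all (mem y) (toList vs))

  lincomb-∈ : {k : ℕ} (y : X) (vs : Vec Vect k) → AllIn y vs → (c : Vec F k) → T (mem y (lincomb c vs))
  lincomb-∈ y V.[]       _    V.[]      = ∈-𝟎 y
  lincomb-∈ y (v V.∷ vs) vs⊆y (b V.∷ c) = let (v∈y , rest) = ∧-elim {mem y v} vs⊆y in
    ∈-⊞ y (b ⊡ v) (lincomb c vs) (∈-⊡ y b v v∈y) (lincomb-∈ y vs rest c)

  isZero⇒≡𝟎 : {k : ℕ} (c : Vec F k) → T (isZero c) → c ≡ 𝟎
  isZero⇒≡𝟎 V.[]      _ = refl
  isZero⇒≡𝟎 (a V.∷ c) t = let (a≟0 , rest) = ∧-elim {⌊ a ≟F 0F ⌋} t in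
    cong₂ V._∷_ (toWitness a≟0) (isZero⇒≡𝟎 c rest)

  isZero-𝟎 : (k : ℕ) → T (isZero (𝟎 {k}))
  isZero-𝟎 zero    = tt
  isZero-𝟎 (suc k) = ∧-intro {⌊ 0F ≟F 0F ⌋} (fromWitness refl) (isZero-𝟎 k)

  Independent : {k : ℕ} → Vec Vect k → Set
  Independent vs = ∀ c → lincomb c vs ≡ 𝟎 → c ≡ 𝟎

  independent⇒Independent : {k : ℕ} (vs : Vec Vect k) → T (independent vs) → Independent vs
  independent⇒Independent {k} vs t c lincomb≡𝟎 = isZero⇒≡𝟎 c
    (⇒-elim {isZero (lincomb c vs)} (all-elim (coefficients-complete k) _ t c) (subst (T ∘ isZero) (sym lincomb≡𝟎) (isZero-𝟎 N)))

  Independent⇒independent : {k : ℕ} (vs : Vec Vect k) → Independent vs → T (independent vs)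
  Independent⇒independent {k} vs indep = all-intro (coefficients-complete k) _ (λ c → ⇒-intro {isZero (lincomb c vs)}
    (λ t → subst (T ∘ isZero) (sym (indep c (isZero⇒≡𝟎 _ t))) (isZero-𝟎 k)))

  lincomb-injective : {k : ℕ} (vs : Vec Vect k) → Independent vs → (c d : Vec F k) → lincomb c vs ≡ lincomb d vs → c ≡ d
  lincomb-injective vs indep c d eq =
    x∙y⁻¹≈ε⇒x≈y c d (indep (c ⊟ d) (trans (lincomb-⊟ c d vs) (trans (cong (_⊟ lincomb d vs) eq) (⊞-inverseʳ _))))

  inSpan : {k : ℕ} → Vec Vect k → Vect → Bool
  inSpan {k} vs u = any (λ c → ⌊ lincomb c vs ≟v u ⌋) (vecsOver k elements)

  inSpan⇒∃ : {k : ℕ} (vs : Vec Vect k) (u : Vect) → T (inSpan vs u) → ∃ λ c → lincomb c vs ≡ u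
  inSpan⇒∃ {k} vs u t = let (c , eq) = any-elim _ (vecsOver k elements) t in c , toWitness eq

  ∃⇒inSpan : {k : ℕ} (vs : Vec Vect k) (c : Vec F k) → T (inSpan vs (lincomb c vs))
  ∃⇒inSpan {k} vs c = any-intro (coefficients-complete k) _ c (fromWitness refl)

  ∣span∣ : {k : ℕ} (vs : Vec Vect k) → Independent vs → ∣ inSpan vs ∣ ≡ q ^ k
  ∣span∣ {k} vs indep = begin
    ∑ allVecs (𝟙 ∘ inSpan vs)                                   ≡⟨ ∑-cong allVecs (λ u → 𝟙-any (≡-dec _≟F_) (coefficients-enumerate k) _ (unique u)) ⟩
    ∑ allVecs (λ u → ∑ cs (λ c → δ _≟v_ (lincomb c vs) u))    ≡⟨ ∑-comm allVecs cs _ ⟩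
    ∑ cs (λ c → ∑ allVecs (δ _≟v_ (lincomb c vs)))            ≡⟨ ∑-cong cs (λ c → enumerates-flip _≟v_ allVecs-enumerate (lincomb c vs)) ⟩
    ∑ cs (λ _ → 1)                                              ≡⟨ ∑-vecsOver-1 k elements ⟩
    q ^ k                                                       ∎
    where
    open ≡-Reasoning
    cs = vecsOver k elements
    unique : ∀ u c d → T ⌊ lincomb c vs ≟v u ⌋ → T ⌊ lincomb d vs ≟v u ⌋ → c ≡ d
    unique u c d c↦u d↦u = lincomb-injective vs indep c d (trans (toWitness c↦u) (sym (toWitness d↦u)))

  independent-length≤N : {k : ℕ} (vs : Vec Vect k) → Independent vs → k ≤ N
  independent-length≤N {k} vs indep = ^-cancelˡ-≤ 1<q k N (subst (_≤ q ^ N) (∣span∣ vs indep) (∣∣≤q^N (inSpan vs)))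

  module _ (y : X) where

    dimUpTo≤ : ∀ n → dimUpTo y n ≤ n
    dimUpTo≤ zero    = z≤n
    dimUpTo≤ (suc n) with hasIndep y (suc n)
    ... | true  = ≤-refl
    ... | false = m≤n⇒m≤1+n (dimUpTo≤ n)

    dimUpTo-attained : ∀ n → dimUpTo y n ≡ 0 ⊎ T (hasIndep y (dimUpTo y n))
    dimUpTo-attained zero    = inj₁ refl
    dimUpTo-attained (suc n) with hasIndep y (suc n) in eq
    ... | true  = inj₂ (subst T (sym eq) tt)
    ... | false = dimUpTo-attained n

    dimUpTo-maximal : ∀ n k → dimUpTo y n < k → k ≤ n → ¬ T (hasIndep y k)
    dimUpTo-maximal zero    k d<k k≤0 _ = <⇒≱ d<k k≤0
    dimUpTo-maximal (suc n) k d<k k≤1+n t with hasIndep y (suc n) in eq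
    ... | true  = <⇒≱ d<k k≤1+n
    ... | false with m≤n⇒m<n∨m≡n k≤1+n
    ...   | inj₁ (s≤s k≤n) = dimUpTo-maximal n k d<k k≤n t
    ...   | inj₂ refl      = subst T eq t

  no-independent-beyond-dim : (y : X) (vs : Vec Vect (suc (dim y))) → AllIn y vs → ¬ Independent vs
  no-independent-beyond-dim y vs vs⊆y indep with suc (dim y) ℕ.≤? N
  ... | yes 1+d≤N = dimUpTo-maximal y N (suc (dim y)) ≤-refl 1+d≤N
       (any-intro (vecsOver-complete (suc (dim y))) _ vs (∧-intro vs⊆y (Independent⇒independent vs indep)))
    where
    vecsOver-complete : (k : ℕ) (ws : Vec Vect k) → ws ∈ vecsOver k allVecs
    vecsOver-complete k = enumerates⇒∈ _ (vecsOver-enumerates _≟v_ allVecs-enumerate k)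
  ... | no 1+d≰N = 1+d≰N (independent-length≤N vs indep)

  basis : (y : X) → Σ[ vs ∈ Vec Vect (dim y) ] (AllIn y vs × Independent vs)
  basis y with dimUpTo-attained y N
  ... | inj₂ t = let (vs , t′) = any-elim (λ vs → all (mem y) (toList vs) ∧ independent vs) (vecsOver (dim y) allVecs) t
                     (vs⊆y , indep) = ∧-elim {all (mem y) (toList vs)} t′
                 in vs , vs⊆y , independent⇒Independent vs indep
  ... | inj₁ d≡0 = subst (λ d → Σ[ vs ∈ Vec Vect d ] (AllIn y vs × Independent vs)) (sym d≡0)
                         (V.[] , tt , λ { V.[] _ → refl })

  independent-∷ : {k : ℕ} (vs : Vec Vect k) → Independent vs → (v : Vect) → ¬ T (inSpan vs v) → Independent (v V.∷ vs)
  independent-∷ vs indep v v∉span (a V.∷ cs) lincomb≡𝟎 with a ≟F 0F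
  ... | yes refl = cong (0F V.∷_) (indep cs (begin
        lincomb cs vs             ≡⟨ sym (⊞-identityˡ _) ⟩
        𝟎 ⊞ lincomb cs vs         ≡⟨ cong (_⊞ lincomb cs vs) (sym (⊡-zeroˡ v)) ⟩
        0F ⊡ v ⊞ lincomb cs vs    ≡⟨ lincomb≡𝟎 ⟩
        𝟎                         ∎))
    where open ≡-Reasoning
  ... | no a≢0 = ⊥-elim (v∉span (subst (T ∘ inSpan vs) v≡lincomb (∃⇒inSpan vs (b′ ⊡ cs))))
    where
    open ≡-Reasoning
    b = proj₁ (inverse a a≢0)
    b′ = b ⊗ (⊖ 1F)
    w = lincomb cs vs
    av≡-w : a ⊡ v ≡ ⊝ w
    av≡-w = begin
      a ⊡ v                 ≡⟨ sym (//-rightDividesʳ w (a ⊡ v)) ⟩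
      (a ⊡ v ⊞ w) ⊟ w       ≡⟨ cong (_⊟ w) lincomb≡𝟎 ⟩
      𝟎 ⊟ w                 ≡⟨ ⊞-identityˡ (⊝ w) ⟩
      ⊝ w                   ∎
    v≡lincomb : lincomb (b′ ⊡ cs) vs ≡ v
    v≡lincomb = begin
      lincomb (b′ ⊡ cs) vs  ≡⟨ lincomb-⊡ b′ cs vs ⟩
      b′ ⊡ w                ≡⟨ ⊡-assoc b (⊖ 1F) w ⟩
      b ⊡ (⊝ w)             ≡⟨ cong (b ⊡_) (sym av≡-w) ⟩
      b ⊡ a ⊡ v             ≡⟨ sym (⊡-assoc b a v) ⟩
      (b ⊗ a) ⊡ v           ≡⟨ cong (_⊡ v) (trans (R.*-comm b a) (proj₂ (inverse a a≢0))) ⟩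
      1F ⊡ v                ≡⟨ ⊡-identityˡ v ⟩
      v                     ∎

  ∈⇔inSpan-basis : (y : X) (u : Vect) → (T (mem y u) → T (inSpan (proj₁ (basis y)) u)) × (T (inSpan (proj₁ (basis y)) u) → T (mem y u))
  ∈⇔inSpan-basis y u = ∈⇒inSpan , inSpan⇒∈
    where
    vs = proj₁ (basis y)
    vs⊆y = proj₁ (proj₂ (basis y))
    indep = proj₂ (proj₂ (basis y))
    ∈⇒inSpan : T (mem y u) → T (inSpan vs u)
    ∈⇒inSpan u∈y with T? (inSpan vs u)
    ... | yes u∈span = u∈span
    ... | no u∉span  = ⊥-elim (no-independent-beyond-dim y (u V.∷ vs) (∧-intro u∈y vs⊆y) (independent-∷ vs indep u u∉span))
    inSpan⇒∈ : T (inSpan vs u) → T (mem y u)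
    inSpan⇒∈ t = let (c , c↦u) = inSpan⇒∃ vs u t in subst (T ∘ mem y) c↦u (lincomb-∈ y vs vs⊆y c)

  ∣y∣≡q^dim : (y : X) → ∣ mem y ∣ ≡ q ^ dim y
  ∣y∣≡q^dim y = trans (∑-cong allVecs (λ u → let (⇒ , ⇐) = ∈⇔inSpan-basis y u in 𝟙-cong ⇒ ⇐))
                      (∣span∣ (proj₁ (basis y)) (proj₂ (proj₂ (basis y))))

  _∖_ : (Vect → Bool) → (Vect → Bool) → Vect → Bool
  (b ∖ a) u = b u ∧ not (a u)

  ∣∣-mono : (a b : Vect → Bool) → a ⊆ b → ∣ a ∣ ≤ ∣ b ∣
  ∣∣-mono a b a⊆b = ∑-mono-≤ allVecs (λ u → 𝟙-≤ (a⊆b u))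

  ∣∣-split : (a b : Vect → Bool) → a ⊆ b → ∣ a ∣ + ∣ b ∖ a ∣ ≡ ∣ b ∣
  ∣∣-split a b a⊆b = trans (sym (∑-distrib-+ allVecs _ _)) (∑-cong allVecs split)
    where
    split : ∀ u → 𝟙 (a u) + 𝟙 ((b ∖ a) u) ≡ 𝟙 (b u)
    split u with a u in au | b u in bu
    ... | true  | true  = refl
    ... | true  | false = ⊥-elim (subst T bu (a⊆b u (subst T (sym au) tt)))
    ... | false | true  = refl
    ... | false | false = refl

  ∣∣-≡⇒⊇ : (a b : Vect → Bool) → a ⊆ b → ∣ a ∣ ≡ ∣ b ∣ → b ⊆ a
  ∣∣-≡⇒⊇ a b a⊆b ∣a∣≡∣b∣ u bu with T? (a u)
  ... | yes au = au
  ... | no ¬au = ⊥-elim (<-irrefl ∣a∣≡∣b∣ (∑-mono-< allVecs (λ w → 𝟙-≤ (a⊆b w)) (allVecs-complete u) 𝟙au<𝟙bu))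
    where
    𝟙au<𝟙bu : 𝟙 (a u) < 𝟙 (b u)
    𝟙au<𝟙bu = subst₂ _<_ (sym (𝟙-false ¬au)) (sym (𝟙-true bu)) ≤-refl

  _≈X_ : X → X → Set
  y ≈X z = (mem y ⊆ mem z) × (mem z ⊆ mem y)

  ≤X⇒⊆ : (y z : X) → T (y ≤X z) → mem y ⊆ mem z
  ≤X⇒⊆ y z t u u∈y = ⇒-elim {mem y u} (all-elim allVecs-complete _ t u) u∈y

  ⊆⇒≤X : (y z : X) → mem y ⊆ mem z → T (y ≤X z)
  ⊆⇒≤X y z y⊆z = all-intro allVecs-complete _ (λ u → ⇒-intro {mem y u} (y⊆z u))

  eqX⇒≈X : (y z : X) → T (eqX y z) → y ≈X z
  eqX⇒≈X y z t = (λ u → ⇒-elim {mem y u} (proj₁ (both u))) , (λ u → ⇒-elim {mem z u} (proj₂ (both u)))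
    where
    both : ∀ u → T (not (mem y u) ∨ mem z u) × T (not (mem z u) ∨ mem y u)
    both u = ∧-elim {not (mem y u) ∨ mem z u} (all-elim allVecs-complete _ t u)

  ≈X⇒eqX : (y z : X) → y ≈X z → T (eqX y z)
  ≈X⇒eqX y z (y⊆z , z⊆y) =
    all-intro allVecs-complete _ (λ u → ∧-intro (⇒-intro {mem y u} (y⊆z u)) (⇒-intro {mem z u} (z⊆y u)))

  covers⇒ : (z y : X) → T (covers z y) → (mem y ⊆ mem z) × (dim z ≡ suc (dim y))
  covers⇒ z y t = let (y≤z , dim≡) = ∧-elim {y ≤X z} t in ≤X⇒⊆ y z y≤z , toWitness dim≡

  ⇒covers : (z y : X) → mem y ⊆ mem z → dim z ≡ suc (dim y) → T (covers z y)
  ⇒covers z y y⊆z dim≡ = ∧-intro (⊆⇒≤X y z y⊆z) (fromWitness dim≡)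

  dim-mono : (y z : X) → mem y ⊆ mem z → dim y ≤ dim z
  dim-mono y z y⊆z = ^-cancelˡ-≤ 1<q (dim y) (dim z) (subst₂ _≤_ (∣y∣≡q^dim y) (∣y∣≡q^dim z) (∣∣-mono _ _ y⊆z))

  dim-≡⇒⊇ : (y z : X) → mem y ⊆ mem z → dim y ≡ dim z → mem z ⊆ mem y
  dim-≡⇒⊇ y z y⊆z dim≡ = ∣∣-≡⇒⊇ (mem y) (mem z) y⊆z (trans (∣y∣≡q^dim y) (trans (cong (q ^_) dim≡) (sym (∣y∣≡q^dim z))))

  ≈X⇒dim≡ : (y z : X) → y ≈X z → dim y ≡ dim z
  ≈X⇒dim≡ y z (y⊆z , z⊆y) = ≤-antisym (dim-mono y z y⊆z) (dim-mono z y z⊆y)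

  dim-< : (y z : X) → mem y ⊆ mem z → (u : Vect) → T (mem z u) → ¬ T (mem y u) → dim y < dim z
  dim-< y z y⊆z u u∈z u∉y = ≰⇒> (λ dz≤dy → u∉y (dim-≡⇒⊇ y z y⊆z (≤-antisym (dim-mono y z y⊆z) dz≤dy) u u∈z))

  dim≤N : (y : X) → dim y ≤ N
  dim≤N y = dimUpTo≤ y N

  ∈-unscale : (y : X) (a : F) → a ≢ 0F → (v : Vect) → T (mem y (a ⊡ v)) → T (mem y v)
  ∈-unscale y a a≢0 v av∈y = subst (T ∘ mem y) b·a·v≡v (∈-⊡ y b (a ⊡ v) av∈y)
    where
    b = proj₁ (inverse a a≢0)
    b·a·v≡v : b ⊡ a ⊡ v ≡ v
    b·a·v≡v = trans (sym (⊡-assoc b a v)) (trans (cong (_⊡ v) (trans (R.*-comm b a) (proj₂ (inverse a a≢0)))) (⊡-identityˡ v))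

  spanWith : X → Vect → Vect → Bool
  spanWith y v u = any (λ c → mem y (u ⊟ c ⊡ v)) elements

  module _ (y : X) (v : Vect) where

    private
      shifted : Vect → F → Bool
      shifted u c = mem y (u ⊟ c ⊡ v)

    spanWith-intro : ∀ u c → T (mem y (u ⊟ c ⊡ v)) → T (spanWith y v u)
    spanWith-intro u c = any-intro elements-complete (shifted u) c

    spanWith-elim : ∀ u → T (spanWith y v u) → ∃ λ c → T (mem y (u ⊟ c ⊡ v))
    spanWith-elim u = any-elim (shifted u) elements

    spanWith-isSubspace : IsSubspace (spanWith y v)
    spanWith-isSubspace = isSubspace-intro (spanWith y v) has-𝟎 closed-⊞ closed-⊡
      where
      has-𝟎 : T (spanWith y v 𝟎)
      has-𝟎 = spanWith-intro 𝟎 0F (subst (T ∘ mem y) (sym (trans (cong (𝟎 ⊟_) (⊡-zeroˡ v)) (⊞-inverseʳ 𝟎))) (∈-𝟎 y))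
      closed-⊞ : ∀ u w → T (spanWith y v u) → T (spanWith y v w) → T (spanWith y v (u ⊞ w))
      closed-⊞ u w u∈ w∈ = let (a , ua) = spanWith-elim u u∈
                               (b , wb) = spanWith-elim w w∈
                           in spanWith-intro (u ⊞ w) (a ⊕ b) (subst (T ∘ mem y) (⊟⊡-⊞ u w v a b) (∈-⊞ y _ _ ua wb))
      closed-⊡ : ∀ c u → T (spanWith y v u) → T (spanWith y v (c ⊡ u))
      closed-⊡ c u u∈ = let (a , ua) = spanWith-elim u u∈ in
        spanWith-intro (c ⊡ u) (c ⊗ a) (subst (T ∘ mem y) (⊡-⊟⊡ c a u v) (∈-⊡ y c _ ua))

  _+⟨_⟩ : X → Vect → X
  y +⟨ v ⟩ = spanWith y v , spanWith-isSubspace y v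

  +⟨⟩-⊇ : (y : X) (v : Vect) → mem y ⊆ mem (y +⟨ v ⟩)
  +⟨⟩-⊇ y v u u∈y = spanWith-intro y v u 0F (subst (T ∘ mem y) (sym (trans (cong (u ⊟_) (⊡-zeroˡ v)) (⊟-identityʳ u))) u∈y)

  +⟨⟩-∋ : (y : X) (v : Vect) → T (mem (y +⟨ v ⟩) v)
  +⟨⟩-∋ y v = spanWith-intro y v v 1F (subst (T ∘ mem y) (sym (trans (cong (v ⊟_) (⊡-identityˡ v)) (⊞-inverseʳ v))) (∈-𝟎 y))

  +⟨⟩-least : (y : X) (v : Vect) (z : X) → mem y ⊆ mem z → T (mem z v) → mem (y +⟨ v ⟩) ⊆ mem z
  +⟨⟩-least y v z y⊆z v∈z u u∈ = let (c , uc) = spanWith-elim y v u u∈ in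
    subst (T ∘ mem z) (//-rightDividesˡ (c ⊡ v) u) (∈-⊞ z _ _ (y⊆z _ uc) (∈-⊡ z c v v∈z))

  shift-unique : (y : X) (v : Vect) → ¬ T (mem y v) → (u : Vect) (c d : F) →
                 T (mem y (u ⊟ c ⊡ v)) → T (mem y (u ⊟ d ⊡ v)) → c ≡ d
  shift-unique y v v∉y u c d uc ud with (c ⊕ ((⊖ 1F) ⊗ d)) ≟F 0F
  ... | yes c-d≡0 = AdditiveF.x∙y⁻¹≈ε⇒x≈y c d (trans (cong (c ⊕_) (sym (RingF.-1*x≈-x d))) c-d≡0)
  ... | no c-d≢0  = ⊥-elim (v∉y (∈-unscale y _ c-d≢0 v (subst (T ∘ mem y) (⊟⊡-⊟ u v c d) (∈-⊟ y _ _ ud uc))))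

  ∣+⟨⟩∣ : (y : X) (v : Vect) → ¬ T (mem y v) → ∣ spanWith y v ∣ ≡ q * ∣ mem y ∣
  ∣+⟨⟩∣ y v v∉y = begin
    ∑ allVecs (𝟙 ∘ spanWith y v)                                  ≡⟨ ∑-cong allVecs (λ u → 𝟙-any _≟F_ elements-enumerate _ (shift-unique y v v∉y u)) ⟩
    ∑ allVecs (λ u → ∑ elements (λ c → 𝟙 (mem y (u ⊟ c ⊡ v))))   ≡⟨ ∑-comm allVecs elements _ ⟩
    ∑ elements (λ c → ∑ allVecs (λ u → 𝟙 (mem y (u ⊟ c ⊡ v))))   ≡⟨ ∑-cong elements (λ c → ∑-translate (c ⊡ v) (𝟙 ∘ mem y)) ⟩
    ∑ elements (λ _ → ∣ mem y ∣)                                  ≡⟨ ∑-const elements _ ⟩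
    q * ∣ mem y ∣                                                 ∎
    where open ≡-Reasoning

  dim-+⟨⟩ : (y : X) (v : Vect) → ¬ T (mem y v) → dim (y +⟨ v ⟩) ≡ suc (dim y)
  dim-+⟨⟩ y v v∉y = ^-injectiveʳ 1<q _ _ (trans (sym (∣y∣≡q^dim (y +⟨ v ⟩))) (trans (∣+⟨⟩∣ y v v∉y) (cong (q *_) (∣y∣≡q^dim y))))

  _∩_ : X → X → X
  y ∩ w = (λ u → mem y u ∧ mem w u) , isSubspace-intro _ (∧-intro (∈-𝟎 y) (∈-𝟎 w))
    (λ u v u∈ v∈ → let (uy , uw) = ∧-elim {mem y u} u∈ ; (vy , vw) = ∧-elim {mem y v} v∈ in
                   ∧-intro (∈-⊞ y u v uy vy) (∈-⊞ w u v uw vw))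
    (λ c u u∈ → let (uy , uw) = ∧-elim {mem y u} u∈ in ∧-intro (∈-⊡ y c u uy) (∈-⊡ w c u uw))

  ∩-⊆ˡ : (y w : X) → mem (y ∩ w) ⊆ mem y
  ∩-⊆ˡ y w u u∈ = proj₁ (∧-elim {mem y u} u∈)

  ∩-⊆ʳ : (y w : X) → mem (y ∩ w) ⊆ mem w
  ∩-⊆ʳ y w u u∈ = proj₂ (∧-elim {mem y u} u∈)

  -- Elements of X carry a membership function, so one subspace has many descriptions;
  -- sums over allX only make sense for functions that respect ≈X.
  RespectsX : (X → ℕ) → Set
  RespectsX g = ∀ z z′ → z ≈X z′ → g z ≡ g z′

  private
    Table : Set
    Table = Vec Bool (length allVecs)

    tables : List Table
    tables = vecsOver (length allVecs) (true ∷ false ∷ [])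

    lookupTable : Table → Vect → Bool
    lookupTable bs = tableLookup allVecs (toList bs)

    tableOf : (m : Vect → Bool) (xs : List Vect) → Vec Bool (length xs)
    tableOf m []       = V.[]
    tableOf m (u ∷ us) = m u V.∷ tableOf m us

    lookup-tableOf : (m : Vect → Bool) (xs : List Vect) (v : Vect) → v ∈ xs → tableLookup xs (toList (tableOf m xs)) v ≡ m v
    lookup-tableOf m (u ∷ us) v v∈ with u ≟v v
    lookup-tableOf m (u ∷ us) v v∈          | yes refl = refl
    lookup-tableOf m (u ∷ us) v (here refl) | no u≢u   = ⊥-elim (u≢u refl)
    lookup-tableOf m (u ∷ us) v (there v∈)  | no _     = lookup-tableOf m us v v∈

    lookup-injective : (xs : List Vect) → AtMostOnce _≟v_ xs → (m : Vect → Bool) (bs : Vec Bool (length xs)) →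
                       (∀ v → v ∈ xs → tableLookup xs (toList bs) v ≡ m v) → bs ≡ tableOf m xs
    lookup-injective []       _    m V.[]       _      = refl
    lookup-injective (u ∷ us) once m (b V.∷ bs) agrees = cong₂ V._∷_ head (lookup-injective us (atMostOnce-tail _≟v_ u us once) m bs tail)
      where
      head : b ≡ m u
      head with agrees u (here refl)
      ... | eq with u ≟v u
      ...   | yes _   = eq
      ...   | no u≢u  = ⊥-elim (u≢u refl)
      tail : ∀ v → v ∈ us → tableLookup us (toList bs) v ≡ m v
      tail v v∈ with agrees v (there v∈)
      ... | eq with u ≟v v
      ...   | yes refl = ⊥-elim (atMostOnce-head∉ _≟v_ u us once v∈)
      ...   | no _     = eq

    isSubspace-resp : (m m′ : Vect → Bool) → (∀ u → m u ≡ m′ u) → IsSubspace m → IsSubspace m′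
    isSubspace-resp m m′ m≗m′ sub = isSubspace-intro m′ (to (subspace-𝟎 {m} sub))
      (λ u v mu mv → to (subspace-⊞ {m} sub u v (from mu) (from mv))) (λ c u mu → to (subspace-⊡ {m} sub c u (from mu)))
      where
      to : ∀ {u} → T (m u) → T (m′ u)
      to {u} = subst T (m≗m′ u)
      from : ∀ {u} → T (m′ u) → T (m u)
      from {u} = subst T (sym (m≗m′ u))

    ∑-mapMaybe : {A : Set} (f : A → Maybe X) (xs : List A) (h : X → ℕ) →
                 ∑ (mapMaybe f xs) h ≡ ∑ xs (λ x → maybe h 0 (f x))
    ∑-mapMaybe f []       h = refl
    ∑-mapMaybe f (x ∷ xs) h with f x
    ... | nothing = ∑-mapMaybe f xs h
    ... | just z  = cong (h z +_) (∑-mapMaybe f xs h)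

  -- allX lists the Boolean tables over allVecs that describe subspaces, and s is described by one table only.
  ∑X-δ : (s : X) (g : X → ℕ) → RespectsX g → ∑ allX (λ z → 𝟙 (eqX z s) * g z) ≡ g s
  ∑X-δ s g g-resp = begin
    ∑ allX h                                             ≡⟨ ∑-mapMaybe _ tables h ⟩
    ∑ tables (λ bs → maybe h 0 (toX (lookupTable bs)))   ≡⟨ ∑-cong tables only-s ⟩
    ∑ tables (λ bs → δ (≡-dec Bool._≟_) bs ts * g s)     ≡⟨ ∑-δ (≡-dec Bool._≟_) tables-enumerate ts (λ _ → g s) ⟩
    g s                                                  ∎
    where
    open ≡-Reasoning
    h = λ z → 𝟙 (eqX z s) * g z
    tables-enumerate = vecsOver-enumerates Bool._≟_ booleans-enumerate (length allVecs)
    ts = tableOf (mem s) allVecs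
    lookup-ts : ∀ v → lookupTable ts v ≡ mem s v
    lookup-ts v = lookup-tableOf (mem s) allVecs v (allVecs-complete v)
    only-s : ∀ bs → maybe h 0 (toX (lookupTable bs)) ≡ δ (≡-dec Bool._≟_) bs ts * g s
    only-s bs with ≡-dec Bool._≟_ bs ts
    only-s bs | yes refl with T? (isSubspaceB (lookupTable ts))
    ... | yes sub = trans (cong (_* g (lookupTable ts , sub)) (𝟙-true ts≡s))
                          (trans (+-identityʳ _) (trans (g-resp _ s (eqX⇒≈X (lookupTable ts , sub) s ts≡s)) (sym (+-identityʳ _))))
      where
      ts≡s : T (eqX (lookupTable ts , sub) s)
      ts≡s = ≈X⇒eqX (lookupTable ts , sub) s ((λ u → subst T (lookup-ts u)) , (λ u → subst T (sym (lookup-ts u))))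
    ... | no ¬sub = ⊥-elim (¬sub (isSubspace-resp (mem s) (lookupTable ts) (sym ∘ lookup-ts) (proj₂ s)))
    only-s bs | no bs≢ts with T? (isSubspaceB (lookupTable bs))
    ... | no _    = refl
    ... | yes sub with T? (eqX (lookupTable bs , sub) s)
    ...   | no ¬bs≡s = cong (_* g (lookupTable bs , sub)) (𝟙-false ¬bs≡s)
    ...   | yes bs≡s = ⊥-elim (bs≢ts (lookup-injective allVecs (enumerates⇒atMostOnce _≟v_ allVecs-enumerate) (mem s) bs
                       (λ v _ → let (⊆ , ⊇) = eqX⇒≈X (lookupTable bs , sub) s bs≡s in Bool-ext (⊆ v) (⊇ v))))

  ∑X-𝟙-class : (s : X) (P : X → Bool) → (∀ z → T (P z) → z ≈X s) → (∀ z → z ≈X s → T (P z)) → ∑ allX (𝟙 ∘ P) ≡ 1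
  ∑X-𝟙-class s P P⇒≈ ≈⇒P = trans (∑-cong allX P≗δ) (∑X-δ s (λ _ → 1) (λ _ _ _ → refl))
    where
    P≗δ : ∀ z → 𝟙 (P z) ≡ 𝟙 (eqX z s) * 1
    P≗δ z = trans (𝟙-cong (λ Pz → ≈X⇒eqX z s (P⇒≈ z Pz)) (λ z≡s → ≈⇒P z (eqX⇒≈X z s z≡s))) (sym (*-identityʳ _))

  𝕍 : X
  𝕍 = (λ _ → true) , isSubspace-intro _ tt (λ _ _ _ _ → tt) (λ _ _ _ → tt)

  𝕆 : X
  𝕆 = isZeroV , isSubspace-intro isZeroV (fromWitness refl) closed-⊞ closed-⊡
    where
    isZeroV : Vect → Bool
    isZeroV u = ⌊ u ≟v zeroV ⌋
    closed-⊞ : ∀ u v → T (isZeroV u) → T (isZeroV v) → T (isZeroV (u ⊞ v))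
    closed-⊞ u v u≡0 v≡0 = fromWitness (trans (cong₂ _⊞_ (toWitness u≡0) (toWitness v≡0)) (⊞-identityˡ zeroV))
    closed-⊡ : ∀ c u → T (isZeroV u) → T (isZeroV (c ⊡ u))
    closed-⊡ c u u≡0 = fromWitness (trans (cong (c ⊡_) (toWitness u≡0)) (⊡-zeroʳ c))

  𝕆-⊆ : (y : X) → mem 𝕆 ⊆ mem y
  𝕆-⊆ y u u≡0 = subst (T ∘ mem y) (sym (toWitness u≡0)) (∈-𝟎 y)

  dim-𝕍 : dim 𝕍 ≡ N
  dim-𝕍 = ^-injectiveʳ 1<q _ _ (trans (sym (∣y∣≡q^dim 𝕍)) (∑-vecsOver-1 N elements))

  dim-𝕆 : dim 𝕆 ≡ 0
  dim-𝕆 = ^-injectiveʳ 1<q _ _ (trans (sym (∣y∣≡q^dim 𝕆)) (count≡1 allVecs-enumerate zeroV))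

  count : (X → Bool) → ℕ
  count P = ∑ allX (𝟙 ∘ P)

  count-none : (P : X → Bool) → (∀ z → ¬ T (P z)) → count P ≡ 0
  count-none = ∑-𝟙-none allX

  ∑X-𝟙*-const : (P : X → Bool) (g : X → ℕ) (K : ℕ) → (∀ z → T (P z) → g z ≡ K) → ∑ allX (λ z → 𝟙 (P z) * g z) ≡ count P * K
  ∑X-𝟙*-const P g K g≡K = trans (∑-cong allX on-P) (∑-*ʳ allX K _)
    where
    on-P : ∀ z → 𝟙 (P z) * g z ≡ 𝟙 (P z) * K
    on-P z with T? (P z)
    ... | yes Pz = cong (𝟙 (P z) *_) (g≡K z Pz)
    ... | no ¬Pz = trans (cong (_* g z) (𝟙-false ¬Pz)) (sym (cong (_* K) (𝟙-false ¬Pz)))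

  double-count : (P : X → Bool) (y : X) →
                 ∑ allX (λ z → 𝟙 (P z) * ∣ mem z ∖ mem y ∣) ≡ ∑ allVecs (λ u → count (λ z → P z ∧ (mem z ∖ mem y) u))
  double-count P y = begin
    ∑ allX (λ z → 𝟙 (P z) * ∑ allVecs (λ u → 𝟙 ((mem z ∖ mem y) u)))   ≡⟨ ∑-cong allX (λ z → sym (∑-*ˡ allVecs (𝟙 (P z)) _)) ⟩
    ∑ allX (λ z → ∑ allVecs (λ u → 𝟙 (P z) * 𝟙 ((mem z ∖ mem y) u)))   ≡⟨ ∑-cong allX (λ z → ∑-cong allVecs (λ u → sym (𝟙-∧ (P z) _))) ⟩
    ∑ allX (λ z → ∑ allVecs (λ u → 𝟙 (P z ∧ (mem z ∖ mem y) u)))        ≡⟨ ∑-comm allX allVecs _ ⟩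
    ∑ allVecs (λ u → count (λ z → P z ∧ (mem z ∖ mem y) u))              ∎
    where open ≡-Reasoning

  ∣∖∣ : (z y : X) → mem y ⊆ mem z → (j : ℕ) → dim z ≡ dim y + j → q ^ dim y + ∣ mem z ∖ mem y ∣ ≡ q ^ dim y * q ^ j
  ∣∖∣ z y y⊆z j dim≡ = begin
    q ^ dim y + ∣ mem z ∖ mem y ∣     ≡⟨ cong (_+ ∣ mem z ∖ mem y ∣) (sym (∣y∣≡q^dim y)) ⟩
    ∣ mem y ∣ + ∣ mem z ∖ mem y ∣     ≡⟨ ∣∣-split (mem y) (mem z) y⊆z ⟩
    ∣ mem z ∣                         ≡⟨ ∣y∣≡q^dim z ⟩
    q ^ dim z                         ≡⟨ cong (q ^_) dim≡ ⟩
    q ^ (dim y + j)                   ≡⟨ ^-distribˡ-+-* q (dim y) j ⟩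
    q ^ dim y * q ^ j                 ∎
    where open ≡-Reasoning

  -- c ≡⟦ k ⟧ says that c is the q-number [k]_q = (q^k − 1)/(q − 1), without dividing.
  _≡⟦_⟧ : ℕ → ℕ → Set
  c ≡⟦ k ⟧ = c * q-1 + 1 ≡ q ^ k

  Atom Coatom UpperCover LowerCover : X → X → X → Bool
  Atom       y w z = covers z y ∧ (z ≤X w)
  Coatom     y w z = covers w z ∧ (y ≤X z)
  UpperCover y w z = covers z w ∧ (y ≤X z)
  LowerCover y w z = covers y z ∧ (z ≤X w)

  q^≡1+q^∸1 : (j : ℕ) → q ^ j ≡ suc (q ^ j ∸ 1)
  q^≡1+q^∸1 j = sym (m+[n∸m]≡n (m^n>0 q j))

  ∣∖∣≡ : (z y : X) → mem y ⊆ mem z → (j : ℕ) → dim z ≡ dim y + j → ∣ mem z ∖ mem y ∣ ≡ q ^ dim y * (q ^ j ∸ 1)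
  ∣∖∣≡ z y y⊆z j dim≡ = +-cancelˡ-≡ (q ^ dim y) _ _ (begin
    q ^ dim y + ∣ mem z ∖ mem y ∣         ≡⟨ ∣∖∣ z y y⊆z j dim≡ ⟩
    q ^ dim y * q ^ j                     ≡⟨ cong (q ^ dim y *_) (q^≡1+q^∸1 j) ⟩
    q ^ dim y * suc (q ^ j ∸ 1)           ≡⟨ *-suc (q ^ dim y) _ ⟩
    q ^ dim y + q ^ dim y * (q ^ j ∸ 1)   ∎)
    where open ≡-Reasoning

  ∣∖∣-cover : (z y : X) → T (covers z y) → ∣ mem z ∖ mem y ∣ ≡ q-1 * q ^ dim y
  ∣∖∣-cover z y z⋗y = let (y⊆z , dim≡) = covers⇒ z y z⋗y in
    trans (∣∖∣≡ z y y⊆z 1 (trans dim≡ (+-comm 1 (dim y)))) (trans (cong (λ p → q ^ dim y * (p ∸ 1)) (*-identityʳ q)) (*-comm (q ^ dim y) q-1))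

  atoms-through : (y w : X) → mem y ⊆ mem w → (u : Vect) → count (λ z → Atom y w z ∧ (mem z ∖ mem y) u) ≡ 𝟙 ((mem w ∖ mem y) u)
  atoms-through y w y⊆w u with T? ((mem w ∖ mem y) u)
  ... | yes u∈w∖y = trans (∑X-𝟙-class (y +⟨ u ⟩) _ is-y+u contains-u) (sym (𝟙-true u∈w∖y))
    where
    u∈w = proj₁ (∧-elim {mem w u} u∈w∖y)
    u∉y = not-elim (proj₂ (∧-elim {mem w u} u∈w∖y))
    is-y+u : ∀ z → T (Atom y w z ∧ (mem z ∖ mem y) u) → z ≈X (y +⟨ u ⟩)
    is-y+u z t = let (atom , u∈z∖y) = ∧-elim {Atom y w z} t
                     (z⋗y , _) = ∧-elim {covers z y} atom
                     (y⊆z , dim-z) = covers⇒ z y z⋗y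
                     y+u⊆z = +⟨⟩-least y u z y⊆z (proj₁ (∧-elim {mem z u} u∈z∖y))
                 in dim-≡⇒⊇ (y +⟨ u ⟩) z y+u⊆z (trans (dim-+⟨⟩ y u u∉y) (sym dim-z)) , y+u⊆z
    contains-u : ∀ z → z ≈X (y +⟨ u ⟩) → T (Atom y w z ∧ (mem z ∖ mem y) u)
    contains-u z (z⊆ , ⊇z) = ∧-intro {Atom y w z}
      (∧-intro {covers z y} (⇒covers z y (λ v v∈y → ⊇z v (+⟨⟩-⊇ y u v v∈y)) (trans (≈X⇒dim≡ z (y +⟨ u ⟩) (z⊆ , ⊇z)) (dim-+⟨⟩ y u u∉y)))
                            (⊆⇒≤X z w (λ v v∈z → +⟨⟩-least y u w y⊆w u∈w v (z⊆ v v∈z))))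
      (∧-intro {mem z u} (⊇z u (+⟨⟩-∋ y u)) (not-intro u∉y))
  ... | no u∉w∖y = trans (count-none _ (λ z t → u∉w∖y (in-w z t))) (sym (𝟙-false u∉w∖y))
    where
    in-w : ∀ z → T (Atom y w z ∧ (mem z ∖ mem y) u) → T ((mem w ∖ mem y) u)
    in-w z t = let (atom , u∈z∖y) = ∧-elim {Atom y w z} t
                   (_ , z≤w) = ∧-elim {covers z y} atom
                   (u∈z , u∉y) = ∧-elim {mem z u} u∈z∖y
               in ∧-intro {mem w u} (≤X⇒⊆ z w z≤w u u∈z) u∉y

  atom-count : (y w : X) → mem y ⊆ mem w → (k : ℕ) → dim w ≡ dim y + k → count (Atom y w) ≡⟦ k ⟧
  atom-count y w y⊆w k dim-w = *-cancel-factor (q ^ dim y) (count (Atom y w)) q-1 (q ^ k) {{q^-nonZero (dim y)}} (begin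
    count (Atom y w) * (q-1 * q ^ dim y) + q ^ dim y
      ≡⟨ cong (_+ q ^ dim y) (sym (∑X-𝟙*-const (Atom y w) _ _ (λ z atom → ∣∖∣-cover z y (proj₁ (∧-elim {covers z y} atom))))) ⟩
    ∑ allX (λ z → 𝟙 (Atom y w z) * ∣ mem z ∖ mem y ∣) + q ^ dim y
      ≡⟨ cong (_+ q ^ dim y) (trans (double-count (Atom y w) y) (∑-cong allVecs (atoms-through y w y⊆w))) ⟩
    ∣ mem w ∖ mem y ∣ + q ^ dim y
      ≡⟨ +-comm _ (q ^ dim y) ⟩
    q ^ dim y + ∣ mem w ∖ mem y ∣
      ≡⟨ ∣∖∣ w y y⊆w k dim-w ⟩
    q ^ dim y * q ^ k ∎)
    where open ≡-Reasoning


  coatoms-through : (y w : X) (u : Vect) →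
                    count (λ z → Coatom y w z ∧ (mem z ∖ mem y) u) ≡ 𝟙 ((mem w ∖ mem y) u) * count (Coatom (y +⟨ u ⟩) w)
  coatoms-through y w u with T? ((mem w ∖ mem y) u)
  ... | yes u∈w∖y = trans (∑-cong allX (λ z → 𝟙-cong (⇒ z) (⇐ z)))
                          (sym (trans (cong (_* count (Coatom (y +⟨ u ⟩) w)) (𝟙-true u∈w∖y)) (+-identityʳ _)))
    where
    u∉y = not-elim (proj₂ (∧-elim {mem w u} u∈w∖y))
    ⇒ : ∀ z → T (Coatom y w z ∧ (mem z ∖ mem y) u) → T (Coatom (y +⟨ u ⟩) w z)
    ⇒ z t = let (coatom , u∈z∖y) = ∧-elim {Coatom y w z} t
                (w⋗z , y≤z) = ∧-elim {covers w z} coatom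
            in ∧-intro {covers w z} w⋗z (⊆⇒≤X (y +⟨ u ⟩) z (+⟨⟩-least y u z (≤X⇒⊆ y z y≤z) (proj₁ (∧-elim {mem z u} u∈z∖y))))
    ⇐ : ∀ z → T (Coatom (y +⟨ u ⟩) w z) → T (Coatom y w z ∧ (mem z ∖ mem y) u)
    ⇐ z t = let (w⋗z , y+u≤z) = ∧-elim {covers w z} t
                y+u⊆z = ≤X⇒⊆ (y +⟨ u ⟩) z y+u≤z
            in ∧-intro {Coatom y w z} (∧-intro {covers w z} w⋗z (⊆⇒≤X y z (λ v v∈y → y+u⊆z v (+⟨⟩-⊇ y u v v∈y))))
                                      (∧-intro {mem z u} (y+u⊆z u (+⟨⟩-∋ y u)) (not-intro u∉y))
  ... | no u∉w∖y = trans (count-none _ (λ z t → u∉w∖y (in-w z t))) (cong (_* count (Coatom (y +⟨ u ⟩) w)) (sym (𝟙-false u∉w∖y)))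
    where
    in-w : ∀ z → T (Coatom y w z ∧ (mem z ∖ mem y) u) → T ((mem w ∖ mem y) u)
    in-w z t = let (coatom , u∈z∖y) = ∧-elim {Coatom y w z} t
                   (w⋗z , _) = ∧-elim {covers w z} coatom
                   (u∈z , u∉y) = ∧-elim {mem z u} u∈z∖y
               in ∧-intro {mem w u} (proj₁ (covers⇒ w z w⋗z) u u∈z) u∉y

  coatom-double-count : (y w : X) (j : ℕ) → dim w ≡ dim y + suc j →
                        count (Coatom y w) * (q ^ dim y * (q ^ j ∸ 1))
                        ≡ ∑ allVecs (λ u → 𝟙 ((mem w ∖ mem y) u) * count (Coatom (y +⟨ u ⟩) w))
  coatom-double-count y w j dim-w = begin
    count (Coatom y w) * (q ^ dim y * (q ^ j ∸ 1))                     ≡⟨ sym (∑X-𝟙*-const (Coatom y w) _ _ coatom-size) ⟩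
    ∑ allX (λ z → 𝟙 (Coatom y w z) * ∣ mem z ∖ mem y ∣)               ≡⟨ double-count (Coatom y w) y ⟩
    ∑ allVecs (λ u → count (λ z → Coatom y w z ∧ (mem z ∖ mem y) u))  ≡⟨ ∑-cong allVecs (coatoms-through y w) ⟩
    ∑ allVecs (λ u → 𝟙 ((mem w ∖ mem y) u) * count (Coatom (y +⟨ u ⟩) w)) ∎
    where
    open ≡-Reasoning
    coatom-size : ∀ z → T (Coatom y w z) → ∣ mem z ∖ mem y ∣ ≡ q ^ dim y * (q ^ j ∸ 1)
    coatom-size z t = let (w⋗z , y≤z) = ∧-elim {covers w z} t in
      ∣∖∣≡ z y (≤X⇒⊆ y z y≤z) j (suc-injective (trans (sym (proj₂ (covers⇒ w z w⋗z))) (trans dim-w (+-suc (dim y) j))))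

  -- In the step, the interval [y + ⟨u⟩, w] on the right of coatom-double-count is one step shorter.
  CoatomCount : ℕ → Set
  CoatomCount k = (y w : X) → mem y ⊆ mem w → dim w ≡ dim y + k → count (Coatom y w) ≡⟦ k ⟧

  coatom-count-step : (k : ℕ) → CoatomCount (suc k) → CoatomCount (suc (suc k))
  coatom-count-step k IH y w y⊆w dim-w = trans (+-comm (H * q-1) 1) (trans (cong suc H*[q-1]≡r) (sym (q^≡1+q^∸1 (2 + k))))
    where
    open ≡-Reasoning
    a = q ^ dim y
    p = q ^ suc k ∸ 1
    r = q ^ suc (suc k) ∸ 1
    H = count (Coatom y w)
    H′ : Vect → ℕ
    H′ u = count (Coatom (y +⟨ u ⟩) w)
    S = ∑ allVecs (λ u → 𝟙 ((mem w ∖ mem y) u) * H′ u)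
    instance
      a-nonZero : NonZero a
      a-nonZero = q^-nonZero (dim y)
      p-nonZero : NonZero p
      p-nonZero = ℕ.≢-nonZero (λ p≡0 → <-irrefl (sym (trans (q^≡1+q^∸1 (suc k)) (cong suc p≡0))) (^-monoʳ-< q 1<q {0} {suc k} (s≤s z≤n)))
    H′*[q-1]≡p : ∀ u → T ((mem w ∖ mem y) u) → H′ u * q-1 ≡ p
    H′*[q-1]≡p u u∈w∖y = suc-injective (trans (+-comm 1 _) (trans (IH (y +⟨ u ⟩) w y+u⊆w dim-w′) (q^≡1+q^∸1 (suc k))))
      where
      u∉y = not-elim (proj₂ (∧-elim {mem w u} u∈w∖y))
      y+u⊆w = +⟨⟩-least y u w y⊆w (proj₁ (∧-elim {mem w u} u∈w∖y))
      dim-w′ : dim w ≡ dim (y +⟨ u ⟩) + suc k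
      dim-w′ = trans dim-w (trans (+-suc (dim y) (suc k)) (cong (_+ suc k) (sym (dim-+⟨⟩ y u u∉y))))
    S*[q-1]≡arp : S * q-1 ≡ a * r * p
    S*[q-1]≡arp = begin
      S * q-1                                                    ≡⟨ sym (∑-*ʳ allVecs q-1 _) ⟩
      ∑ allVecs (λ u → 𝟙 ((mem w ∖ mem y) u) * H′ u * q-1)       ≡⟨ ∑-cong allVecs on-w∖y ⟩
      ∑ allVecs (λ u → 𝟙 ((mem w ∖ mem y) u) * p)               ≡⟨ ∑-*ʳ allVecs p _ ⟩
      ∣ mem w ∖ mem y ∣ * p                                      ≡⟨ cong (_* p) (∣∖∣≡ w y y⊆w (suc (suc k)) dim-w) ⟩
      a * r * p                                                  ∎
      where
      on-w∖y : ∀ u → 𝟙 ((mem w ∖ mem y) u) * H′ u * q-1 ≡ 𝟙 ((mem w ∖ mem y) u) * p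
      on-w∖y u with T? ((mem w ∖ mem y) u)
      ... | yes u∈ = trans (cong (λ c → c * H′ u * q-1) (𝟙-true u∈))
                           (trans (cong (_* q-1) (+-identityʳ (H′ u)))
                                  (trans (H′*[q-1]≡p u u∈) (sym (trans (cong (_* p) (𝟙-true u∈)) (+-identityʳ p)))))
      ... | no u∉  = trans (cong (λ c → c * H′ u * q-1) (𝟙-false u∉)) (sym (cong (_* p) (𝟙-false u∉)))
    H*[q-1]≡r : H * q-1 ≡ r
    H*[q-1]≡r = *-cancel-factors a p r S H q-1 (coatom-double-count y w (suc k) dim-w) S*[q-1]≡arp

  coatom-count : (k : ℕ) → CoatomCount k
  coatom-count zero          y w y⊆w dim-w = cong (λ c → c * q-1 + 1) (count-none (Coatom y w) no-coatom)
    where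
    no-coatom : ∀ z → ¬ T (Coatom y w z)
    no-coatom z t = let (w⋗z , y≤z) = ∧-elim {covers w z} t in
      1+n≰n (subst (_≤ dim z) (trans (trans (sym (+-identityʳ (dim y))) (sym dim-w)) (proj₂ (covers⇒ w z w⋗z))) (dim-mono y z (≤X⇒⊆ y z y≤z)))
  coatom-count (suc zero)    y w y⊆w dim-w =
    trans (cong (λ c → c * q-1 + 1) (∑X-𝟙-class y (Coatom y w) is-y contains-y))
          (trans (+-comm (q-1 + 0) 1) (sym (trans (*-identityʳ q) (trans q≡1+[q-1] (cong suc (sym (+-identityʳ q-1)))))))
    where
    dim-w≡1+dim-y : dim w ≡ suc (dim y)
    dim-w≡1+dim-y = trans dim-w (+-comm (dim y) 1)
    is-y : ∀ z → T (Coatom y w z) → z ≈X y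
    is-y z t = let (w⋗z , y≤z) = ∧-elim {covers w z} t
                   y⊆z = ≤X⇒⊆ y z y≤z
               in dim-≡⇒⊇ y z y⊆z (suc-injective (trans (sym dim-w≡1+dim-y) (proj₂ (covers⇒ w z w⋗z)))) , y⊆z
    contains-y : ∀ z → z ≈X y → T (Coatom y w z)
    contains-y z (z⊆y , y⊆z) = ∧-intro {covers w z}
      (⇒covers w z (λ v v∈z → y⊆w v (z⊆y v v∈z)) (trans dim-w≡1+dim-y (cong suc (≈X⇒dim≡ y z (y⊆z , z⊆y)))))
      (⊆⇒≤X y z y⊆z)
  coatom-count (suc (suc k)) = coatom-count-step k (coatom-count (suc k))

  atom-count-⊈ : (y w : X) → ¬ (mem y ⊆ mem w) → count (Atom y w) ≡ 0
  atom-count-⊈ y w y⊈w = count-none (Atom y w) (λ z t → let (z⋗y , z≤w) = ∧-elim {covers z y} t in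
    y⊈w (λ u u∈y → ≤X⇒⊆ z w z≤w u (proj₁ (covers⇒ z y z⋗y) u u∈y)))

  coatom-count-⊈ : (y w : X) → ¬ (mem y ⊆ mem w) → count (Coatom y w) ≡ 0
  coatom-count-⊈ y w y⊈w = count-none (Coatom y w) (λ z t → let (w⋗z , y≤z) = ∧-elim {covers w z} t in
    y⊈w (λ u u∈y → proj₁ (covers⇒ w z w⋗z) u (≤X⇒⊆ y z y≤z u u∈y)))

  upperCover-count : (y w : X) → mem y ⊆ mem w → count (UpperCover y w) ≡ count (Atom w 𝕍)
  upperCover-count y w y⊆w = ∑-cong allX (λ z → 𝟙-cong (⇒ z) (⇐ z))
    where
    ⇒ : ∀ z → T (UpperCover y w z) → T (Atom w 𝕍 z)
    ⇒ z t = ∧-intro {covers z w} (proj₁ (∧-elim {covers z w} t)) (⊆⇒≤X z 𝕍 (λ _ _ → tt))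
    ⇐ : ∀ z → T (Atom w 𝕍 z) → T (UpperCover y w z)
    ⇐ z t = let z⋗w = proj₁ (∧-elim {covers z w} t) in
      ∧-intro {covers z w} z⋗w (⊆⇒≤X y z (λ u u∈y → proj₁ (covers⇒ z w z⋗w) u (y⊆w u u∈y)))

  lowerCover-count : (y w : X) → mem y ⊆ mem w → count (LowerCover y w) ≡ count (Coatom 𝕆 y)
  lowerCover-count y w y⊆w = ∑-cong allX (λ z → 𝟙-cong (⇒ z) (⇐ z))
    where
    ⇒ : ∀ z → T (LowerCover y w z) → T (Coatom 𝕆 y z)
    ⇒ z t = ∧-intro {covers y z} (proj₁ (∧-elim {covers y z} t)) (⊆⇒≤X 𝕆 z (𝕆-⊆ z))
    ⇐ : ∀ z → T (Coatom 𝕆 y z) → T (LowerCover y w z)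
    ⇐ z t = let y⋗z = proj₁ (∧-elim {covers y z} t) in
      ∧-intro {covers y z} y⋗z (⊆⇒≤X z w (λ u u∈z → y⊆w u (proj₁ (covers⇒ y z y⋗z) u u∈z)))

  ⊈⇒witness : (y w : X) → ¬ (mem y ⊆ mem w) → ∃ λ v → T (mem y v) × ¬ T (mem w v)
  ⊈⇒witness y w y⊈w with T? (any (λ v → mem y v ∧ not (mem w v)) allVecs)
  ... | yes t = let (v , v∈y∖w) = any-elim _ allVecs t
                    (v∈y , v∉w) = ∧-elim {mem y v} v∈y∖w
                in v , v∈y , not-elim v∉w
  ... | no ¬t = ⊥-elim (y⊈w y⊆w)
    where
    y⊆w : mem y ⊆ mem w
    y⊆w u u∈y with T? (mem w u)
    ... | yes u∈w = u∈w
    ... | no u∉w  = ⊥-elim (¬t (any-intro allVecs-complete _ u (∧-intro {mem y u} u∈y (not-intro u∉w))))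

  module Transversal (y w : X) (v : Vect) (v∈y : T (mem y v)) (v∉w : ¬ T (mem w v)) where

    w+v = w +⟨ v ⟩

    upperCover-is-w+v : ∀ z → T (UpperCover y w z) → z ≈X w+v
    upperCover-is-w+v z t = let (z⋗w , y≤z) = ∧-elim {covers z w} t
                                (w⊆z , dim-z) = covers⇒ z w z⋗w
                                w+v⊆z = +⟨⟩-least w v z w⊆z (≤X⇒⊆ y z y≤z v v∈y)
                            in dim-≡⇒⊇ w+v z w+v⊆z (trans (dim-+⟨⟩ w v v∉w) (sym dim-z)) , w+v⊆z

    upperCover-count-⊈ : count (UpperCover y w) ≡ 𝟙 (y ≤X w+v)
    upperCover-count-⊈ with T? (y ≤X w+v)
    ... | yes y≤w+v = trans (∑X-𝟙-class w+v (UpperCover y w) upperCover-is-w+v is-upperCover) (sym (𝟙-true y≤w+v))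
      where
      is-upperCover : ∀ z → z ≈X w+v → T (UpperCover y w z)
      is-upperCover z (z⊆ , ⊇z) = ∧-intro {covers z w}
        (⇒covers z w (λ u u∈w → ⊇z u (+⟨⟩-⊇ w v u u∈w)) (trans (≈X⇒dim≡ z w+v (z⊆ , ⊇z)) (dim-+⟨⟩ w v v∉w)))
        (⊆⇒≤X y z (λ u u∈y → ⊇z u (≤X⇒⊆ y w+v y≤w+v u u∈y)))
    ... | no y≰w+v = trans (count-none (UpperCover y w) none) (sym (𝟙-false y≰w+v))
      where
      none : ∀ z → ¬ T (UpperCover y w z)
      none z t = y≰w+v (⊆⇒≤X y w+v (λ u u∈y → proj₁ (upperCover-is-w+v z t) u (≤X⇒⊆ y z (proj₂ (∧-elim {covers z w} t)) u u∈y)))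

    y∩w = y ∩ w

    v∉y∩w : ¬ T (mem y∩w v)
    v∉y∩w v∈ = v∉w (∩-⊆ʳ y w v v∈)

    y⊆y∩w+v : T (y ≤X w+v) → mem y ⊆ mem (y∩w +⟨ v ⟩)
    y⊆y∩w+v y≤w+v u u∈y = let (c , u-cv∈w) = spanWith-elim w v u (≤X⇒⊆ y w+v y≤w+v u u∈y) in
      spanWith-intro y∩w v u c (∧-intro {mem y (u ⊟ c ⊡ v)} (∈-⊟ y u _ u∈y (∈-⊡ y c v v∈y)) u-cv∈w)

    dim-y : T (y ≤X w+v) → dim y ≡ suc (dim y∩w)
    dim-y y≤w+v = trans (≈X⇒dim≡ y (y∩w +⟨ v ⟩) (y⊆y∩w+v y≤w+v , +⟨⟩-least y∩w v y (∩-⊆ˡ y w) v∈y)) (dim-+⟨⟩ y∩w v v∉y∩w)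

    lowerCover-⊆ : ∀ z → T (LowerCover y w z) → mem z ⊆ mem y∩w
    lowerCover-⊆ z t u u∈z = let (y⋗z , z≤w) = ∧-elim {covers y z} t in
      ∧-intro {mem y u} (proj₁ (covers⇒ y z y⋗z) u u∈z) (≤X⇒⊆ z w z≤w u u∈z)

    lowerCover-count-⊈ : count (LowerCover y w) ≡ 𝟙 (y ≤X w+v)
    lowerCover-count-⊈ with T? (y ≤X w+v)
    ... | yes y≤w+v = trans (∑X-𝟙-class y∩w (LowerCover y w) is-y∩w is-lowerCover) (sym (𝟙-true y≤w+v))
      where
      is-y∩w : ∀ z → T (LowerCover y w z) → z ≈X y∩w
      is-y∩w z t = lowerCover-⊆ z t , dim-≡⇒⊇ z y∩w (lowerCover-⊆ z t)
        (suc-injective (trans (sym (proj₂ (covers⇒ y z (proj₁ (∧-elim {covers y z} t))))) (dim-y y≤w+v)))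
      is-lowerCover : ∀ z → z ≈X y∩w → T (LowerCover y w z)
      is-lowerCover z (z⊆ , ⊇z) = ∧-intro {covers y z}
        (⇒covers y z (λ u u∈z → ∩-⊆ˡ y w u (z⊆ u u∈z)) (trans (dim-y y≤w+v) (cong suc (≈X⇒dim≡ y∩w z (⊇z , z⊆)))))
        (⊆⇒≤X z w (λ u u∈z → ∩-⊆ʳ y w u (z⊆ u u∈z)))
    ... | no y≰w+v = trans (count-none (LowerCover y w) none) (sym (𝟙-false y≰w+v))
      where
      none : ∀ z → ¬ T (LowerCover y w z)
      none z t = y≰w+v (⊆⇒≤X y w+v (λ u u∈y → +⟨⟩-least y∩w v w+v (λ x x∈ → +⟨⟩-⊇ w v x (∩-⊆ʳ y w x x∈)) (+⟨⟩-∋ w v) u (y⊆y∩w+v′ u u∈y)))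
        where
        y⋗z = proj₁ (∧-elim {covers y z} t)
        dim-y∩w+v≡dim-y : dim (y∩w +⟨ v ⟩) ≡ dim y
        dim-y∩w+v≡dim-y = trans (dim-+⟨⟩ y∩w v v∉y∩w) (≤-antisym (dim-< y∩w y (∩-⊆ˡ y w) v v∈y v∉y∩w)
          (subst (_≤ suc (dim y∩w)) (sym (proj₂ (covers⇒ y z y⋗z))) (s≤s (dim-mono z y∩w (lowerCover-⊆ z t)))))
        y⊆y∩w+v′ : mem y ⊆ mem (y∩w +⟨ v ⟩)
        y⊆y∩w+v′ = dim-≡⇒⊇ (y∩w +⟨ v ⟩) y (+⟨⟩-least y∩w v y (∩-⊆ˡ y w) v∈y) dim-y∩w+v≡dim-y

  γ : X → ℕ
  γ y = q ^ ((N ∸ dim y) C 2)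

  weight : X → X → ℕ
  weight y z = q ^ ((N ∸ dim z) * dim y)

  G : X → X → ℕ
  G y z = 𝟙 (y ≤X z) * weight y z

  ≤X-resp : (y z z′ : X) → z ≈X z′ → (y ≤X z) ≡ (y ≤X z′)
  ≤X-resp y z z′ (z⊆z′ , z′⊆z) = Bool-ext (λ t → ⊆⇒≤X y z′ (λ u u∈y → z⊆z′ u (≤X⇒⊆ y z t u u∈y)))
                                          (λ t → ⊆⇒≤X y z (λ u u∈y → z′⊆z u (≤X⇒⊆ y z′ t u u∈y)))

  G-resp : (y : X) → RespectsX (G y)
  G-resp y z z′ z≈z′ = cong₂ (λ b d → 𝟙 b * q ^ ((N ∸ d) * dim y)) (≤X-resp y z z′ z≈z′) (≈X⇒dim≡ z z′ z≈z′)

  eqX-sym : (w z : X) → eqX w z ≡ eqX z w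
  eqX-sym w z = Bool-ext (λ t → let (w⊆z , z⊆w) = eqX⇒≈X w z t in ≈X⇒eqX z w (z⊆w , w⊆z))
                         (λ t → let (z⊆w , w⊆z) = eqX⇒≈X z w t in ≈X⇒eqX w z (w⊆z , z⊆w))

  updown-at : (y w : X) → updown y w ≡ ℕ→ℚ (γ y * G y w)
  updown-at y w = begin
    qℚ^ ((N ∸ dim y) C 2) Q.* ΣX (λ z → (if y ≤X z then qℚ^ ((N ∸ dim z) * dim y) ·ᵥ hat z else 0ᵥ) w)
      ≡⟨ cong (ℕ→ℚ (γ y) Q.*_) (∑ℚ-cong allX term) ⟩
    ℕ→ℚ (γ y) Q.* ∑ℚ allX (λ z → ℕ→ℚ (𝟙 (eqX z w) * G y z))
      ≡⟨ cong (ℕ→ℚ (γ y) Q.*_) (trans (∑ℚ-ℕ→ℚ allX _) (cong ℕ→ℚ (∑X-δ w (G y) (G-resp y)))) ⟩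
    ℕ→ℚ (γ y) Q.* ℕ→ℚ (G y w)
      ≡⟨ sym (ℕ→ℚ-* (γ y) (G y w)) ⟩
    ℕ→ℚ (γ y * G y w) ∎
    where
    open ≡-Reasoning
    term : ∀ z → (if y ≤X z then qℚ^ ((N ∸ dim z) * dim y) ·ᵥ hat z else 0ᵥ) w ≡ ℕ→ℚ (𝟙 (eqX z w) * G y z)
    term z with y ≤X z
    ... | true  = scaled-hat
      where
      scaled-hat : ℕ→ℚ (weight y z) Q.* hat z w ≡ ℕ→ℚ (𝟙 (eqX z w) * (1 * weight y z))
      scaled-hat with eqX z w
      ... | true  = trans (ℚP.*-identityʳ (ℕ→ℚ (weight y z))) (cong ℕ→ℚ (sym (trans (+-identityʳ (1 * weight y z)) (+-identityʳ (weight y z)))))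
      ... | false = ℚP.*-zeroʳ (ℕ→ℚ (weight y z))
    ... | false = cong ℕ→ℚ (sym (*-zeroʳ (𝟙 (eqX z w))))

  covers-asym : (w z : X) → T (covers w z) → ¬ T (covers z w)
  covers-asym w z w⋗z z⋗w = 1+n≰n (≤-trans (n≤1+n (suc (dim z)))
    (≤-reflexive (sym (trans (proj₂ (covers⇒ z w z⋗w)) (cong suc (proj₂ (covers⇒ w z w⋗z)))))))

  A-entry : (w z : X) → A w z ≡ ℕ→ℚ (𝟙 (covers w z) + 𝟙 (covers z w) * q ^ dim w)
  A-entry w z with covers w z in w⋗z | covers z w in z⋗w
  ... | true  | true  = ⊥-elim (covers-asym w z (subst T (sym w⋗z) tt) (subst T (sym z⋗w) tt))
  ... | true  | false = refl
  ... | false | true  = cong ℕ→ℚ (sym (+-identityʳ (q ^ dim w)))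
  ... | false | false = refl

  -- K₁, K₂ are the contributions of one z with w ⋗ z resp. z ⋗ w to (A ∙ updown y) w;
  -- L₁, L₂ below those of one z with y ⋗ z resp. z ⋗ y to the sums on the right.
  K₁ K₂ : X → X → ℕ
  K₁ y w = q ^ ((N ∸ (dim w ∸ 1)) * dim y)
  K₂ y w = q ^ dim w * q ^ ((N ∸ suc (dim w)) * dim y)

  A-updown-at : (y w : X) → (A ∙ updown y) w ≡ ℕ→ℚ (γ y * (count (Coatom y w) * K₁ y w + count (UpperCover y w) * K₂ y w))
  A-updown-at y w = begin
    ∑ℚ allX (λ z → A w z Q.* updown y z)                    ≡⟨ ∑ℚ-cong allX (λ z → cong₂ Q._*_ (A-entry w z) (updown-at y z)) ⟩
    ∑ℚ allX (λ z → ℕ→ℚ (a z) Q.* ℕ→ℚ (γ y * G y z))        ≡⟨ ∑ℚ-cong allX (λ z → sym (ℕ→ℚ-* (a z) _)) ⟩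
    ∑ℚ allX (λ z → ℕ→ℚ (a z * (γ y * G y z)))               ≡⟨ ∑ℚ-ℕ→ℚ allX _ ⟩
    ℕ→ℚ (∑ allX (λ z → a z * (γ y * G y z)))                ≡⟨ cong ℕ→ℚ (trans (∑-cong allX (λ z → swap (a z) (γ y) (G y z))) (∑-*ˡ allX (γ y) _)) ⟩
    ℕ→ℚ (γ y * ∑ allX (λ z → a z * G y z))                  ≡⟨ cong (λ s → ℕ→ℚ (γ y * s)) split ⟩
    ℕ→ℚ (γ y * (count (Coatom y w) * K₁ y w + count (UpperCover y w) * K₂ y w)) ∎
    where
    open ≡-Reasoning
    open ℕSolver.+-*-Solver
    a : X → ℕ
    a z = 𝟙 (covers w z) + 𝟙 (covers z w) * q ^ dim w
    swap : ∀ a b c → a * (b * c) ≡ b * (a * c)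
    swap = solve 3 (λ a b c → a :* (b :* c) := b :* (a :* c)) refl
    below : ∀ z → 𝟙 (covers w z) * G y z ≡ 𝟙 (Coatom y w z) * weight y z
    below z = trans (sym (*-assoc (𝟙 (covers w z)) _ _)) (cong (_* weight y z) (sym (𝟙-∧ (covers w z) _)))
    above : ∀ z → 𝟙 (covers z w) * q ^ dim w * G y z ≡ 𝟙 (UpperCover y w z) * (q ^ dim w * weight y z)
    above z = trans (solve 4 (λ a b c e → a :* b :* (c :* e) := a :* c :* (b :* e)) refl (𝟙 (covers z w)) (q ^ dim w) (𝟙 (y ≤X z)) (weight y z))
                    (cong (_* (q ^ dim w * weight y z)) (sym (𝟙-∧ (covers z w) _)))
    weight-below : ∀ z → T (Coatom y w z) → weight y z ≡ K₁ y w
    weight-below z t = cong (λ d → q ^ ((N ∸ d) * dim y)) (sym (cong (_∸ 1) (proj₂ (covers⇒ w z (proj₁ (∧-elim {covers w z} t))))))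
    weight-above : ∀ z → T (UpperCover y w z) → q ^ dim w * weight y z ≡ K₂ y w
    weight-above z t = cong (λ d → q ^ dim w * q ^ ((N ∸ d) * dim y)) (proj₂ (covers⇒ z w (proj₁ (∧-elim {covers z w} t))))
    split : ∑ allX (λ z → a z * G y z) ≡ count (Coatom y w) * K₁ y w + count (UpperCover y w) * K₂ y w
    split = begin
      ∑ allX (λ z → a z * G y z)
        ≡⟨ trans (∑-cong allX (λ z → *-distribʳ-+ (G y z) (𝟙 (covers w z)) _)) (∑-distrib-+ allX _ _) ⟩
      ∑ allX (λ z → 𝟙 (covers w z) * G y z) + ∑ allX (λ z → 𝟙 (covers z w) * q ^ dim w * G y z)
        ≡⟨ cong₂ _+_ (trans (∑-cong allX below) (∑X-𝟙*-const (Coatom y w) _ _ weight-below))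
                     (trans (∑-cong allX above) (∑X-𝟙*-const (UpperCover y w) _ _ weight-above)) ⟩
      count (Coatom y w) * K₁ y w + count (UpperCover y w) * K₂ y w ∎

  A*-updown-at : (y w : X) → (A* ∙ updown y) w ≡ qℚ^- (dim w) Q.* ℕ→ℚ (γ y * G y w)
  A*-updown-at y w = begin
    ∑ℚ allX (λ z → A* w z Q.* updown y z)                              ≡⟨ ∑ℚ-cong allX term ⟩
    ∑ℚ allX (λ z → qℚ^- (dim w) Q.* ℕ→ℚ (𝟙 (eqX z w) * (γ y * G y z)))  ≡⟨ ∑ℚ-*ˡ allX (qℚ^- (dim w)) _ ⟩
    qℚ^- (dim w) Q.* ∑ℚ allX (λ z → ℕ→ℚ (𝟙 (eqX z w) * (γ y * G y z)))  ≡⟨ cong (qℚ^- (dim w) Q.*_) (∑ℚ-ℕ→ℚ allX _) ⟩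
    qℚ^- (dim w) Q.* ℕ→ℚ (∑ allX (λ z → 𝟙 (eqX z w) * (γ y * G y z)))  ≡⟨ cong (λ n → qℚ^- (dim w) Q.* ℕ→ℚ n) (∑X-δ w _ γG-resp) ⟩
    qℚ^- (dim w) Q.* ℕ→ℚ (γ y * G y w)                                 ∎
    where
    open ≡-Reasoning
    γG-resp : RespectsX (λ z → γ y * G y z)
    γG-resp z z′ z≈z′ = cong (γ y *_) (G-resp y z z′ z≈z′)
    diagonal : (b : Bool) (r : ℚ) (n : ℕ) → (if b then r else 0ℚ) Q.* ℕ→ℚ n ≡ r Q.* ℕ→ℚ (𝟙 b * n)
    diagonal true  r n = cong (λ m → r Q.* ℕ→ℚ m) (sym (+-identityʳ n))
    diagonal false r n = trans (ℚP.*-zeroˡ (ℕ→ℚ n)) (sym (ℚP.*-zeroʳ r))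
    term : ∀ z → A* w z Q.* updown y z ≡ qℚ^- (dim w) Q.* ℕ→ℚ (𝟙 (eqX z w) * (γ y * G y z))
    term z = trans (cong (A* w z Q.*_) (updown-at y z))
                   (trans (diagonal (eqX w z) (qℚ^- (dim w)) _) (cong (λ b → qℚ^- (dim w) Q.* ℕ→ℚ (𝟙 b * (γ y * G y z))) (eqX-sym w z)))

  updown-sum-at : (P : X → Bool) (w : X) (L : ℕ) → (∀ z → T (P z) → γ z * weight z w ≡ L) →
                  ΣXᵥ (λ z → if P z then updown z else 0ᵥ) w ≡ ℕ→ℚ (count (λ z → P z ∧ (z ≤X w)) * L)
  updown-sum-at P w L γweight≡L = begin
    ∑ℚ allX (λ z → (if P z then updown z else 0ᵥ) w)          ≡⟨ ∑ℚ-cong allX term ⟩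
    ∑ℚ allX (λ z → ℕ→ℚ (𝟙 (P z ∧ (z ≤X w)) * (γ z * weight z w)))  ≡⟨ ∑ℚ-ℕ→ℚ allX _ ⟩
    ℕ→ℚ (∑ allX (λ z → 𝟙 (P z ∧ (z ≤X w)) * (γ z * weight z w)))  ≡⟨ cong ℕ→ℚ (∑X-𝟙*-const _ _ L (λ z t → γweight≡L z (proj₁ (∧-elim {P z} t)))) ⟩
    ℕ→ℚ (count (λ z → P z ∧ (z ≤X w)) * L)                     ∎
    where
    open ≡-Reasoning
    open ℕSolver.+-*-Solver
    term : ∀ z → (if P z then updown z else 0ᵥ) w ≡ ℕ→ℚ (𝟙 (P z ∧ (z ≤X w)) * (γ z * weight z w))
    term z with P z
    ... | true  = trans (updown-at z w) (cong ℕ→ℚ (solve 3 (λ a b c → a :* (b :* c) := b :* (a :* c)) refl (γ z) (𝟙 (z ≤X w)) (weight z w)))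
    ... | false = refl

  L₁ L₂ : X → X → ℕ
  L₁ y w = q ^ ((N ∸ (dim y ∸ 1)) C 2) * q ^ ((N ∸ dim w) * (dim y ∸ 1))
  L₂ y w = q ^ ((N ∸ suc (dim y)) C 2) * q ^ ((N ∸ dim w) * suc (dim y))

  lower-sum-at : (y w : X) → ΣXᵥ (λ z → if covers y z then updown z else 0ᵥ) w ≡ ℕ→ℚ (count (LowerCover y w) * L₁ y w)
  lower-sum-at y w = updown-sum-at (covers y) w (L₁ y w)
    (λ z y⋗z → cong (λ d → q ^ ((N ∸ d) C 2) * q ^ ((N ∸ dim w) * d)) (cong (_∸ 1) (sym (proj₂ (covers⇒ y z y⋗z)))))

  upper-sum-at : (y w : X) → ΣXᵥ (λ z → if covers z y then updown z else 0ᵥ) w ≡ ℕ→ℚ (count (Atom y w) * L₂ y w)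
  upper-sum-at y w = updown-sum-at (λ z → covers z y) w (L₂ y w)
    (λ z z⋗y → cong (λ d → q ^ ((N ∸ d) C 2) * q ^ ((N ∸ dim w) * d)) (proj₂ (covers⇒ z y z⋗y)))

  ≡⟦0⟧⇒≡0 : (c : ℕ) → c ≡⟦ 0 ⟧ → c ≡ 0
  ≡⟦0⟧⇒≡0 zero    _  = refl
  ≡⟦0⟧⇒≡0 (suc c) eq = ⊥-elim (q-1≢0 (m+n≡0⇒m≡0 q-1 (suc-injective (trans (+-comm 1 _) eq))))

  private
    ∸-from : (M a b : ℕ) → M ≡ a + b → M ∸ a ≡ b
    ∸-from M a b M≡a+b = trans (cong (_∸ a) M≡a+b) (m+n∸m≡n a b)

    pascal : (r : ℕ) → suc r C 2 ≡ r + r C 2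
    pascal r = trans (sym (nCk+nC[k+1]≡[n+1]C[k+1] r 1)) (cong (_+ r C 2) (nC1≡n r))

    q^-+ : (a b : ℕ) → q ^ a * q ^ b ≡ q ^ (a + b)
    q^-+ a b = sym (^-distribˡ-+-* q a b)

  open ℕSolver.+-*-Solver

  coatom-weight : (i d m : ℕ) → i ≤ d → N ≡ d + m → q ^ ((N ∸ (d ∸ 1)) * i) ≡ q ^ ((N ∸ d) * i) * q ^ i
  coatom-weight zero    d       m _   _   =
    trans (cong (q ^_) (trans (*-zeroʳ (N ∸ (d ∸ 1))) (sym (*-zeroʳ (N ∸ d))))) (sym (*-identityʳ (q ^ ((N ∸ d) * 0))))
  coatom-weight (suc i) (suc d) m _   N≡d+m = trans (cong (q ^_) exponent) (sym (q^-+ ((N ∸ suc d) * suc i) (suc i)))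
    where
    exponent : (N ∸ d) * suc i ≡ (N ∸ suc d) * suc i + suc i
    exponent = begin
      (N ∸ d) * suc i             ≡⟨ cong (_* suc i) (∸-from N d (suc m) (trans N≡d+m (sym (+-suc d m)))) ⟩
      suc m * suc i               ≡⟨ solve 2 (λ m i → (con 1 :+ m) :* i := m :* i :+ i) refl m (suc i) ⟩
      m * suc i + suc i           ≡⟨ cong (λ t → t * suc i + suc i) (sym (∸-from N (suc d) m N≡d+m)) ⟩
      (N ∸ suc d) * suc i + suc i ∎
      where open ≡-Reasoning

  -- The factors U and D matter only for m = 0 resp. i = 0, where truncated subtraction
  -- breaks the exponent identity but the count vanishes.
  upper-weight : (i d k m U : ℕ) → d ≡ i + k → N ≡ d + m → U ≡⟦ m ⟧ →
                 U * (q ^ d * q ^ ((N ∸ suc d) * i)) ≡ U * (q ^ k * q ^ ((N ∸ d) * i))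
  upper-weight i d k zero    U _    _         U≡⟦0⟧ rewrite ≡⟦0⟧⇒≡0 U U≡⟦0⟧ = refl
  upper-weight i _ k (suc m) U refl N≡i+k+m _ =
    cong (U *_) (trans (q^-+ (i + k) _) (trans (cong (q ^_) exponent) (sym (q^-+ k _))))
    where
    exponent : i + k + (N ∸ suc (i + k)) * i ≡ k + (N ∸ (i + k)) * i
    exponent = begin
      i + k + (N ∸ suc (i + k)) * i    ≡⟨ cong (λ t → i + k + t * i) (∸-from N (suc (i + k)) m (trans N≡i+k+m (+-suc (i + k) m))) ⟩
      i + k + m * i                    ≡⟨ solve 3 (λ i k m → i :+ k :+ m :* i := k :+ (con 1 :+ m) :* i) refl i k m ⟩
      k + suc m * i                    ≡⟨ cong (λ t → k + t * i) (sym (∸-from N (i + k) (suc m) N≡i+k+m)) ⟩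
      k + (N ∸ (i + k)) * i            ∎
      where open ≡-Reasoning

  lower-weight : (i d k m D : ℕ) → d ≡ i + k → N ≡ d + m → D ≡⟦ i ⟧ →
                 D * (q ^ ((N ∸ (i ∸ 1)) C 2) * q ^ ((N ∸ d) * (i ∸ 1))) ≡ D * (q ^ ((N ∸ i) C 2) * q ^ k * q ^ ((N ∸ d) * i))
  lower-weight zero    d k m D _    _         D≡⟦0⟧ rewrite ≡⟦0⟧⇒≡0 D D≡⟦0⟧ = refl
  lower-weight (suc i) _ k m D refl N≡i+k+m _ = cong (D *_) (begin
    q ^ ((N ∸ i) C 2) * q ^ ((N ∸ (suc i + k)) * i)            ≡⟨ q^-+ ((N ∸ i) C 2) ((N ∸ (suc i + k)) * i) ⟩
    q ^ ((N ∸ i) C 2 + (N ∸ (suc i + k)) * i)                  ≡⟨ cong (q ^_) exponent ⟩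
    q ^ ((N ∸ suc i) C 2 + k + (N ∸ (suc i + k)) * suc i)      ≡⟨ sym (q^-+ ((N ∸ suc i) C 2 + k) ((N ∸ (suc i + k)) * suc i)) ⟩
    q ^ ((N ∸ suc i) C 2 + k) * q ^ ((N ∸ (suc i + k)) * suc i) ≡⟨ cong (_* q ^ ((N ∸ (suc i + k)) * suc i)) (sym (q^-+ ((N ∸ suc i) C 2) k)) ⟩
    q ^ ((N ∸ suc i) C 2) * q ^ k * q ^ ((N ∸ (suc i + k)) * suc i) ∎)
    where
    open ≡-Reasoning
    r = k + m
    N-i : N ∸ i ≡ suc r
    N-i = ∸-from N i (suc r) (trans N≡i+k+m (trans (+-assoc (suc i) k m) (sym (+-suc i r))))
    N-1-i : N ∸ suc i ≡ r
    N-1-i = ∸-from N (suc i) r (trans N≡i+k+m (+-assoc (suc i) k m))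
    N-d : N ∸ (suc i + k) ≡ m
    N-d = ∸-from N (suc i + k) m N≡i+k+m
    exponent : (N ∸ i) C 2 + (N ∸ (suc i + k)) * i ≡ (N ∸ suc i) C 2 + k + (N ∸ (suc i + k)) * suc i
    exponent = begin
      (N ∸ i) C 2 + (N ∸ (suc i + k)) * i      ≡⟨ cong₂ (λ a b → a C 2 + b * i) N-i N-d ⟩
      suc r C 2 + m * i                        ≡⟨ cong (_+ m * i) (pascal r) ⟩
      k + m + r C 2 + m * i                    ≡⟨ solve 4 (λ k m c i → k :+ m :+ c :+ m :* i := c :+ k :+ m :* (con 1 :+ i)) refl k m (r C 2) i ⟩
      r C 2 + k + m * suc i                    ≡⟨ cong₂ (λ a b → a C 2 + k + b * suc i) (sym N-1-i) (sym N-d) ⟩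
      (N ∸ suc i) C 2 + k + (N ∸ (suc i + k)) * suc i ∎

  q^[N∸i] : (i d k m : ℕ) → d ≡ i + k → N ≡ d + m → q ^ (N ∸ i) ≡ q ^ k * q ^ m
  q^[N∸i] i _ k m refl N≡i+k+m = trans (cong (q ^_) (∸-from N i (k + m) (trans N≡i+k+m (+-assoc i k m)))) (sym (q^-+ k m))

  q*γ : (i d k m : ℕ) → d ≡ i + k → N ≡ d + m → i < N → q * q ^ ((N ∸ i) C 2) ≡ q ^ k * q ^ m * q ^ ((N ∸ suc i) C 2)
  q*γ i _ k m refl N≡i+k+m i<N = trans (cong (q ^_) exponent) (sym (trans (cong (_* q ^ ((N ∸ suc i) C 2)) (q^-+ k m)) (q^-+ (k + m) _)))
    where
    s = N ∸ suc i
    N-i : N ∸ i ≡ suc s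
    N-i = ∸-from N i (suc s) (trans (sym (m+[n∸m]≡n i<N)) (sym (+-suc i s)))
    1+s≡k+m : suc s ≡ k + m
    1+s≡k+m = trans (sym N-i) (∸-from N i (k + m) (trans N≡i+k+m (+-assoc i k m)))
    exponent : suc ((N ∸ i) C 2) ≡ k + m + s C 2
    exponent = begin
      suc ((N ∸ i) C 2)     ≡⟨ cong (λ t → suc (t C 2)) N-i ⟩
      suc (suc s C 2)       ≡⟨ cong suc (pascal s) ⟩
      suc (s + s C 2)       ≡⟨ cong (_+ s C 2) 1+s≡k+m ⟩
      k + m + s C 2         ∎
      where open ≡-Reasoning

  atom-weight : (i d m : ℕ) → N ≡ d + m →
                q ^ ((N ∸ suc i) C 2) * q ^ ((N ∸ d) * suc i) ≡ q ^ ((N ∸ suc i) C 2) * q ^ m * q ^ ((N ∸ d) * i)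
  atom-weight i d m N≡d+m = trans (cong (q ^ ((N ∸ suc i) C 2) *_) (trans (cong (q ^_) exponent) (sym (q^-+ m _))))
                                  (sym (*-assoc (q ^ ((N ∸ suc i) C 2)) (q ^ m) _))
    where
    N-d = ∸-from N d m N≡d+m
    exponent : (N ∸ d) * suc i ≡ m + (N ∸ d) * i
    exponent = trans (cong (_* suc i) N-d) (trans (*-suc m i) (cong (λ t → m + t * i) (sym N-d)))

  transversal-weight : (i j d : ℕ) → i ≡ suc j → suc d ≤ N → i ≤ N →
                       q ^ ((N ∸ i) C 2) * (q ^ d * q ^ ((N ∸ suc d) * i)) ≡ q ^ ((N ∸ (i ∸ 1)) C 2) * q ^ ((N ∸ d) * (i ∸ 1))
  transversal-weight _ j d refl 1+d≤N 1+j≤N = begin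
    q ^ ((N ∸ suc j) C 2) * (q ^ d * q ^ ((N ∸ suc d) * suc j))  ≡⟨ cong (q ^ ((N ∸ suc j) C 2) *_) (q^-+ d _) ⟩
    q ^ ((N ∸ suc j) C 2) * q ^ (d + (N ∸ suc d) * suc j)        ≡⟨ q^-+ ((N ∸ suc j) C 2) (d + (N ∸ suc d) * suc j) ⟩
    q ^ ((N ∸ suc j) C 2 + (d + (N ∸ suc d) * suc j))            ≡⟨ cong (q ^_) exponent ⟩
    q ^ ((N ∸ j) C 2 + (N ∸ d) * j)                              ≡⟨ sym (q^-+ ((N ∸ j) C 2) ((N ∸ d) * j)) ⟩
    q ^ ((N ∸ j) C 2) * q ^ ((N ∸ d) * j)                        ∎
    where
    open ≡-Reasoning
    m = N ∸ suc d
    r = N ∸ suc j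
    N≡1+d+m : N ≡ suc d + m
    N≡1+d+m = sym (m+[n∸m]≡n 1+d≤N)
    N≡1+j+r : N ≡ suc j + r
    N≡1+j+r = sym (m+[n∸m]≡n 1+j≤N)
    d+m≡j+r : d + m ≡ j + r
    d+m≡j+r = suc-injective (trans (sym N≡1+d+m) N≡1+j+r)
    N-1-j = ∸-from N (suc j) r N≡1+j+r
    N-j = ∸-from N j (suc r) (trans N≡1+j+r (sym (+-suc j r)))
    N-1-d = ∸-from N (suc d) m N≡1+d+m
    N-d = ∸-from N d (suc m) (trans N≡1+d+m (sym (+-suc d m)))
    exponent : (N ∸ suc j) C 2 + (d + (N ∸ suc d) * suc j) ≡ (N ∸ j) C 2 + (N ∸ d) * j
    exponent = begin
      (N ∸ suc j) C 2 + (d + (N ∸ suc d) * suc j) ≡⟨ cong₂ (λ a b → a C 2 + (d + b * suc j)) N-1-j N-1-d ⟩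
      r C 2 + (d + m * suc j)
        ≡⟨ solve 4 (λ c d m j → c :+ (d :+ m :* (con 1 :+ j)) := c :+ (d :+ m) :+ m :* j) refl (r C 2) d m j ⟩
      r C 2 + (d + m) + m * j                     ≡⟨ cong (λ t → r C 2 + t + m * j) d+m≡j+r ⟩
      r C 2 + (j + r) + m * j                     ≡⟨ solve 4 (λ c j r m → c :+ (j :+ r) :+ m :* j := r :+ c :+ (con 1 :+ m) :* j) refl (r C 2) j r m ⟩
      r + r C 2 + suc m * j                       ≡⟨ cong₂ (λ a b → a + b * j) (sym (pascal r)) (sym N-d) ⟩
      suc r C 2 + (N ∸ d) * j                     ≡⟨ cong (λ t → t C 2 + (N ∸ d) * j) (sym N-j) ⟩
      (N ∸ j) C 2 + (N ∸ d) * j                   ∎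

  -- The two eigen-equations at w ⊇ y with denominators cleared: d = q − 1, (a , b , c) = (q^k , q^m , q^dim y)
  -- for k = dim w − dim y and m = N − dim w, and H, U, D, h are the counts of the corresponding neighbours.
  A-identity : (d γ β H U D a b c K₁ K₂ L₁ P : ℕ) → H * d + 1 ≡ a → U * d + 1 ≡ b → D * d + 1 ≡ c →
               K₁ ≡ β * c → U * K₂ ≡ U * (a * β) → D * L₁ ≡ D * (γ * a * β) → P ≡ a * b →
               d * (γ * (H * K₁ + U * K₂)) + c * (γ * β) ≡ P * (γ * β) + d * (D * L₁)
  A-identity d γ β H U D _ _ _ _ K₂ L₁ _ refl refl refl refl U*K₂≡ D*L₁≡ refl rewrite U*K₂≡ | D*L₁≡ =
    solve 6 (λ d γ β H U D →
        d :* (γ :* (H :* (β :* (D :* d :+ con 1)) :+ U :* ((H :* d :+ con 1) :* β))) :+ (D :* d :+ con 1) :* (γ :* β)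
      := (H :* d :+ con 1) :* (U :* d :+ con 1) :* (γ :* β) :+ d :* (D :* (γ :* (H :* d :+ con 1) :* β))) refl d γ β H U D
    where open ℕSolver.+-*-Solver

  A*-identity : (d h γ γ′ β a b c e P L : ℕ) → h * d + 1 ≡ a → e ≡ c * a → P * γ ≡ a * b * γ′ → L ≡ γ′ * b * β →
                c * P * (γ * β) + d * e * (h * L) ≡ e * P * (γ * β)
  A*-identity d h γ γ′ β _ b c _ P _ refl refl P*γ≡ refl = begin
    c * P * (γ * β) + d * (c * a) * (h * (γ′ * b * β))      ≡⟨ cong (_+ d * (c * a) * (h * (γ′ * b * β))) (regroup c P γ β) ⟩
    c * (P * γ) * β + d * (c * a) * (h * (γ′ * b * β))      ≡⟨ cong (λ t → c * t * β + d * (c * a) * (h * (γ′ * b * β))) P*γ≡ ⟩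
    c * (a * b * γ′) * β + d * (c * a) * (h * (γ′ * b * β)) ≡⟨ collect d h γ′ β b c ⟩
    c * a * (a * b * γ′) * β                                ≡⟨ cong (λ t → c * a * t * β) (sym P*γ≡) ⟩
    c * a * (P * γ) * β                                     ≡⟨ regroup′ c a P γ β ⟩
    c * a * P * (γ * β)                                     ∎
    where
    open ≡-Reasoning
    open ℕSolver.+-*-Solver
    a = h * d + 1
    regroup : ∀ c P γ β → c * P * (γ * β) ≡ c * (P * γ) * β
    regroup = solve 4 (λ c P γ β → c :* P :* (γ :* β) := c :* (P :* γ) :* β) refl
    regroup′ : ∀ c a P γ β → c * a * (P * γ) * β ≡ c * a * P * (γ * β)
    regroup′ = solve 5 (λ c a P γ β → c :* a :* (P :* γ) :* β := c :* a :* P :* (γ :* β)) refl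
    collect : ∀ d h γ′ β b c → c * ((h * d + 1) * b * γ′) * β + d * (c * (h * d + 1)) * (h * (γ′ * b * β))
                              ≡ c * (h * d + 1) * ((h * d + 1) * b * γ′) * β
    collect = solve 6 (λ d h γ′ β b c → c :* ((h :* d :+ con 1) :* b :* γ′) :* β :+ d :* (c :* (h :* d :+ con 1)) :* (h :* (γ′ :* b :* β))
                                      := c :* (h :* d :+ con 1) :* ((h :* d :+ con 1) :* b :* γ′) :* β) refl

  module Interval (y w : X) (y⊆w : mem y ⊆ mem w) where

    i = dim y
    d = dim w
    k = d ∸ i
    m = N ∸ d
    β = weight y w

    d≡i+k : d ≡ i + k
    d≡i+k = sym (m+[n∸m]≡n (dim-mono y w y⊆w))

    N≡d+m : N ≡ d + m
    N≡d+m = sym (m+[n∸m]≡n (dim≤N w))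

    G≡β : G y w ≡ β
    G≡β = trans (cong (_* β) (𝟙-true (⊆⇒≤X y w y⊆w))) (+-identityʳ β)

    coatoms : count (Coatom y w) ≡⟦ k ⟧
    coatoms = coatom-count k y w y⊆w d≡i+k

    atoms : count (Atom y w) ≡⟦ k ⟧
    atoms = atom-count y w y⊆w k d≡i+k

    upperCovers : count (UpperCover y w) ≡⟦ m ⟧
    upperCovers = trans (cong (λ c → c * q-1 + 1) (upperCover-count y w y⊆w)) (atom-count w 𝕍 (λ _ _ → tt) m (trans dim-𝕍 N≡d+m))

    lowerCovers : count (LowerCover y w) ≡⟦ i ⟧
    lowerCovers = trans (cong (λ c → c * q-1 + 1) (lowerCover-count y w y⊆w)) (coatom-count i 𝕆 y (𝕆-⊆ y) (cong (_+ i) (sym dim-𝕆)))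

  A-equation : (y w : X) →
               q-1 * (γ y * (count (Coatom y w) * K₁ y w + count (UpperCover y w) * K₂ y w)) + q ^ dim y * (γ y * G y w)
               ≡ q ^ (N ∸ dim y) * (γ y * G y w) + q-1 * (count (LowerCover y w) * L₁ y w)
  A-equation y w with T? (y ≤X w)
  ... | yes y≤w = subst (λ g → q-1 * (γ y * (H * K₁ y w + U * K₂ y w)) + q ^ i * (γ y * g) ≡ q ^ (N ∸ i) * (γ y * g) + q-1 * (D * L₁ y w))
                        (sym G≡β)
                        (A-identity q-1 (γ y) β H U D (q ^ k) (q ^ m) (q ^ i) (K₁ y w) (K₂ y w) (L₁ y w) (q ^ (N ∸ i))
                          coatoms upperCovers lowerCovers
                          (coatom-weight i d m (dim-mono y w (≤X⇒⊆ y w y≤w)) N≡d+m)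
                          (upper-weight i d k m U d≡i+k N≡d+m upperCovers)
                          (lower-weight i d k m D d≡i+k N≡d+m lowerCovers)
                          (q^[N∸i] i d k m d≡i+k N≡d+m))
    where
    open Interval y w (≤X⇒⊆ y w y≤w)
    H = count (Coatom y w)
    U = count (UpperCover y w)
    D = count (LowerCover y w)
  ... | no y≰w rewrite coatom-count-⊈ y w (y≰w ∘ ⊆⇒≤X y w) | 𝟙-false {y ≤X w} y≰w =
    trans (cong₂ _+_ (cong (q-1 *_) γUK₂≡DL₁) (vanish (q ^ dim y)))
          (trans (+-comm _ 0) (cong (_+ q-1 * (count (LowerCover y w) * L₁ y w)) (sym (vanish (q ^ (N ∸ dim y))))))
    where
    vanish : ∀ a → a * (γ y * 0) ≡ 0
    vanish a = trans (cong (a *_) (*-zeroʳ (γ y))) (*-zeroʳ a)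
    v-witness = ⊈⇒witness y w (y≰w ∘ ⊆⇒≤X y w)
    open Transversal y w (proj₁ v-witness) (proj₁ (proj₂ v-witness)) (proj₂ (proj₂ v-witness))
    γUK₂≡DL₁ : γ y * (count (UpperCover y w) * K₂ y w) ≡ count (LowerCover y w) * L₁ y w
    γUK₂≡DL₁ with T? (y ≤X w+v)
    ... | no  y≰w+v rewrite upperCover-count-⊈ | lowerCover-count-⊈ | 𝟙-false y≰w+v = *-zeroʳ (γ y)
    ... | yes y≤w+v rewrite upperCover-count-⊈ | lowerCover-count-⊈ | 𝟙-true y≤w+v =
      trans (cong (γ y *_) (+-identityʳ (K₂ y w)))
            (trans (transversal-weight (dim y) (dim y∩w) (dim w) (dim-y y≤w+v)
                                       (subst (_≤ N) (dim-+⟨⟩ w _ (proj₂ (proj₂ v-witness))) (dim≤N w+v)) (dim≤N y))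
                   (sym (+-identityʳ (L₁ y w))))

  A*-equation : (y w : X) →
                q ^ dim y * q * (γ y * G y w) + q-1 * q ^ dim w * (count (Atom y w) * L₂ y w) ≡ q ^ dim w * q * (γ y * G y w)
  A*-equation y w with T? (y ≤X w)
  ... | no y≰w rewrite atom-count-⊈ y w (y≰w ∘ ⊆⇒≤X y w) | 𝟙-false {y ≤X w} y≰w =
    solve 5 (λ a b c e g → a :* (g :* con 0) :+ b :* con 0 := e :* (g :* con 0)) refl (q ^ dim y * q) (q-1 * q ^ dim w) (L₂ y w) (q ^ dim w * q) (γ y)
  ... | yes y≤w with dim y ℕ.<? N
  ...   | yes i<N = subst (λ g → q ^ i * q * (γ y * g) + q-1 * q ^ d * (count (Atom y w) * L₂ y w) ≡ q ^ d * q * (γ y * g))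
                          (sym G≡β)
                          (A*-identity q-1 (count (Atom y w)) (γ y) (q ^ ((N ∸ suc i) C 2)) β (q ^ k) (q ^ m) (q ^ i) (q ^ d) q (L₂ y w)
                            atoms (trans (cong (q ^_) d≡i+k) (^-distribˡ-+-* q i k))
                            (q*γ i d k m d≡i+k N≡d+m i<N) (atom-weight i d m N≡d+m))
    where open Interval y w (≤X⇒⊆ y w y≤w)
  ...   | no i≮N = begin
    q ^ i * q * (γ y * G y w) + q-1 * q ^ d * (count (Atom y w) * L₂ y w)
      ≡⟨ cong (λ c → q ^ i * q * (γ y * G y w) + q-1 * q ^ d * (c * L₂ y w)) no-atoms ⟩
    q ^ i * q * (γ y * G y w) + q-1 * q ^ d * 0
      ≡⟨ trans (cong (q ^ i * q * (γ y * G y w) +_) (*-zeroʳ (q-1 * q ^ d))) (+-identityʳ _) ⟩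
    q ^ i * q * (γ y * G y w)                                              ≡⟨ cong (λ e → q ^ e * q * (γ y * G y w)) (sym d≡i) ⟩
    q ^ d * q * (γ y * G y w)                                              ∎
    where
    open ≡-Reasoning
    open Interval y w (≤X⇒⊆ y w y≤w)
    d≡i : dim w ≡ dim y
    d≡i = ≤-antisym (subst (dim w ≤_) (sym (≤-antisym (dim≤N y) (≮⇒≥ i≮N))) (dim≤N w)) (dim-mono y w (≤X⇒⊆ y w y≤w))
    k≡0 : k ≡ 0
    k≡0 = trans (cong (_∸ dim y) d≡i) (n∸n≡0 (dim y))
    no-atoms : count (Atom y w) ≡ 0
    no-atoms = ≡⟦0⟧⇒≡0 (count (Atom y w)) (subst (count (Atom y w) ≡⟦_⟧) k≡0 atoms)

  A-eigenvector-at : (y w : X) →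
                     (A ∙ updown y) w ≡ ((θ (dim y) ·ᵥ updown y) +ᵥ ΣXᵥ (λ z → if covers y z then updown z else 0ᵥ)) w
  A-eigenvector-at y w = begin
    (A ∙ updown y) w         ≡⟨ A-updown-at y w ⟩
    ℕ→ℚ (γ y * S)            ≡⟨ cancel-multiplier (ℕ→ℚ (γ y * S)) (ℕ→ℚ (q ^ i)) (ℕ→ℚ (q ^ (N ∸ i))) t s (ℕ→ℚ q-1) (inv q-1)
                                                    (inv-inverseˡ q-1 {{ℕ.≢-nonZero q-1≢0}}) cleared ⟩
    θ i Q.* t Q.+ s          ≡⟨ cong₂ (λ a b → θ i Q.* a Q.+ b) (sym (updown-at y w)) (sym (lower-sum-at y w)) ⟩
    ((θ i ·ᵥ updown y) +ᵥ ΣXᵥ (λ z → if covers y z then updown z else 0ᵥ)) w ∎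
    where
    open ≡-Reasoning
    i = dim y
    S = count (Coatom y w) * K₁ y w + count (UpperCover y w) * K₂ y w
    t = ℕ→ℚ (γ y * G y w)
    s = ℕ→ℚ (count (LowerCover y w) * L₁ y w)
    cleared : ℕ→ℚ q-1 Q.* ℕ→ℚ (γ y * S) Q.+ ℕ→ℚ (q ^ i) Q.* t ≡ ℕ→ℚ (q ^ (N ∸ i)) Q.* t Q.+ ℕ→ℚ q-1 Q.* s
    cleared = trans (sym (ℕ→ℚ-*+* q-1 (γ y * S) (q ^ i) (γ y * G y w)))
                    (trans (cong ℕ→ℚ (A-equation y w)) (ℕ→ℚ-*+* (q ^ (N ∸ i)) (γ y * G y w) q-1 (count (LowerCover y w) * L₁ y w)))

  A*-eigenvector-at : (y w : X) →
                      (A* ∙ updown y) w ≡ ((θ* (dim y) ·ᵥ updown y)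
                                           +ᵥ (((inv q Q.- 1ℚ) Q.* qℚ^- (dim y)) ·ᵥ ΣXᵥ (λ z → if covers z y then updown z else 0ᵥ))) w
  A*-eigenvector-at y w = begin
    (A* ∙ updown y) w                              ≡⟨ A*-updown-at y w ⟩
    inv (q ^ d) Q.* t                              ≡⟨ cancel-multipliers (inv (q ^ d)) (inv (q ^ i)) (inv q) (ℕ→ℚ (q ^ d)) (ℕ→ℚ (q ^ i)) (ℕ→ℚ q) t s
                                                        (inv-inverseˡ (q ^ d) {{q^-nonZero d}}) (inv-inverseˡ (q ^ i) {{q^-nonZero i}})
                                                        (inv-inverseˡ q) cleared ⟩
    inv (q ^ i) Q.* t Q.+ ((inv q Q.- 1ℚ) Q.* inv (q ^ i)) Q.* s
                                                   ≡⟨ cong₂ (λ a b → inv (q ^ i) Q.* a Q.+ ((inv q Q.- 1ℚ) Q.* inv (q ^ i)) Q.* b)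
                                                            (sym (updown-at y w)) (sym (upper-sum-at y w)) ⟩
    ((θ* i ·ᵥ updown y) +ᵥ (((inv q Q.- 1ℚ) Q.* qℚ^- i) ·ᵥ ΣXᵥ (λ z → if covers z y then updown z else 0ᵥ))) w ∎
    where
    open ≡-Reasoning
    i = dim y
    d = dim w
    t = ℕ→ℚ (γ y * G y w)
    s = ℕ→ℚ (count (Atom y w) * L₂ y w)
    cleared : ℕ→ℚ (q ^ i) Q.* ℕ→ℚ q Q.* t Q.+ (ℕ→ℚ q Q.- 1ℚ) Q.* ℕ→ℚ (q ^ d) Q.* s ≡ ℕ→ℚ (q ^ d) Q.* ℕ→ℚ q Q.* t
    cleared = begin
      ℕ→ℚ (q ^ i) Q.* ℕ→ℚ q Q.* t Q.+ (ℕ→ℚ q Q.- 1ℚ) Q.* ℕ→ℚ (q ^ d) Q.* s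
        ≡⟨ cong₂ (λ a b → a Q.* t Q.+ b Q.* s) (sym (ℕ→ℚ-* (q ^ i) q)) (trans (cong (Q._* ℕ→ℚ (q ^ d)) (ℕ→ℚ-∸1 q)) (sym (ℕ→ℚ-* q-1 (q ^ d)))) ⟩
      ℕ→ℚ (q ^ i * q) Q.* t Q.+ ℕ→ℚ (q-1 * q ^ d) Q.* s
        ≡⟨ sym (ℕ→ℚ-*+* (q ^ i * q) (γ y * G y w) (q-1 * q ^ d) (count (Atom y w) * L₂ y w)) ⟩
      ℕ→ℚ (q ^ i * q * (γ y * G y w) + q-1 * q ^ d * (count (Atom y w) * L₂ y w))
        ≡⟨ cong ℕ→ℚ (A*-equation y w) ⟩
      ℕ→ℚ (q ^ d * q * (γ y * G y w))
        ≡⟨ trans (ℕ→ℚ-* (q ^ d * q) (γ y * G y w)) (cong (Q._* t) (ℕ→ℚ-* (q ^ d) q)) ⟩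
      ℕ→ℚ (q ^ d) Q.* ℕ→ℚ q Q.* t ∎

lemma6p3 : (𝔽 : FiniteField) (N : ℕ) → 1 ≤ N →
    let open FiniteField 𝔽 using (q) in
    let open Setting 𝔽 N in
    (i : ℕ) → i ≤ N → (y : X) → dim y ≡ i →
      (∀ w → (A ∙ updown y) w
               ≡ ((θ i ·ᵥ updown y) +ᵥ ΣXᵥ (λ z → if covers y z then updown z else 0ᵥ)) w)
      × (∀ w → (A* ∙ updown y) w
               ≡ ((θ* i ·ᵥ updown y)
                  +ᵥ (((inv q Q.- Q.1ℚ) Q.* qℚ^- i) ·ᵥ ΣXᵥ (λ z → if covers z y then updown z else 0ᵥ))) w)
lemma6p3 𝔽 N _ _ _ y refl = A-eigenvector-at y , A*-eigenvector-at y
  where open Subspaces 𝔽 N
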